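{- Let $m\geq3$ and let $\hat{\mathbf m}=(m-1)\,m\,(m-2)(m-3)\cdots321\in S_m$. Then $$F_{\hat{\mathbf m}}(x,q)=\frac{(1-x)U_{m-3}(t)-\sqrt x\,(1-x+xq)U_{m-4}(t)}{\sqrt x\,\big((1-x)U_{m-2}(t)-\sqrt{x}\,(1-x+xq)U_{m-3}(t)\big)},\qquad t=\frac{1+x-xq}{2\sqrt x}.$$
   Context: For $\tau\in S_k(312)$, $F_\tau(x,q)=\sum_{n\geq0}\sum_{\sigma\in S_n(312,\tau)}x^nq^{L_n(\sigma)}$, where $S_n(312,\tau)$ is the set of permutations of $[n]$ avoiding the patterns $312$ and $\tau$ (the empty permutation counted for $n=0$), and $L_n(\sigma)$ is the length of a longest increasing subsequence ($0$ for the empty permutation). $U_j$ are the Chebyshev polynomials of the second kind, extended to all integers $j$ by $U_0(t)=1$, $U_1(t)=2t$, $U_j(t)=2tU_{j-1}(t)-U_{j-2}(t)$ for all integers $j$ (so $U_{ -1}=0$). -}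

module Defs where

open import Data.Bool using (Bool; true; false; _∧_; _∨_; if_then_else_)
open import Data.Nat as ℕ using (ℕ; zero; suc; _∸_; _⊔_; _<ᵇ_; _≡ᵇ_)
open import Data.Integer as ℤ using (ℤ; +_)
open import Data.List using (List; []; _∷_; _++_; map; length; filter; concatMap; foldr; zip; upTo)
open import Data.Bool.ListAction using (any; all)
open import Data.Product using (_,_)
open import Relation.Nullary.Decidable using (T?)

_==_ : Bool → Bool → Bool
true  == b = b
false == true  = false
false == false = true

words : ℕ → ℕ → List (List ℕ)
words n zero      = [] ∷ []
words n (suc len) = concatMap (λ a → map (a ∷_) (words n len)) (upTo n)

notIn : ℕ → List ℕ → Bool
notIn a xs = all (λ b → if a ≡ᵇ b then false else true) xs

distinct : List ℕ → Bool
distinct []       = true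
distinct (x ∷ xs) = notIn x xs ∧ distinct xs

-- S_n: the permutations of an n-element set (here {0,…,n-1}),
-- as one-line notation words: injective words of length n over n letters.
perms : ℕ → List (List ℕ)
perms n = filter (λ w → T? (distinct w)) (words n n)

subs : List ℕ → List (List ℕ)
subs []       = [] ∷ []
subs (x ∷ xs) = map (x ∷_) (subs xs) ++ subs xs

orderIso : List ℕ → List ℕ → Bool
orderIso []       []       = true
orderIso (a ∷ as) (b ∷ bs) =
  all (λ { (x , y) → ((a <ᵇ x) == (b <ᵇ y)) ∧ ((x <ᵇ a) == (y <ᵇ b)) }) (zip as bs)
  ∧ orderIso as bs
orderIso _ _ = false

contains : List ℕ → List ℕ → Bool
contains τ σ = any (orderIso τ) (subs σ)

avoids : List ℕ → List ℕ → Bool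
avoids τ σ = if contains τ σ then false else true

increasing : List ℕ → Bool
increasing []           = true
increasing (x ∷ [])     = true
increasing (x ∷ y ∷ ys) = (x <ᵇ y) ∧ increasing (y ∷ ys)

-- L_n(σ): length of a longest increasing subsequence (0 for the empty word)
lis : List ℕ → ℕ
lis σ = foldr _⊔_ 0 (map length (filter (λ w → T? (increasing w)) (subs σ)))

p312 : List ℕ
p312 = 3 ∷ 1 ∷ 2 ∷ []

downFrom : ℕ → List ℕ
downFrom zero    = []
downFrom (suc k) = suc k ∷ downFrom k

hat : ℕ → List ℕ
hat m = (m ∸ 1) ∷ m ∷ downFrom (m ∸ 2)

-- [x^n q^k] F_τ(x,q) = #{σ ∈ S_n(312,τ) : L_n(σ) = k}
Fcoef : List ℕ → ℕ → ℕ → ℕ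
Fcoef τ n k = length (filter (λ σ → T? (avoids p312 σ ∧ avoids τ σ ∧ (lis σ ≡ᵇ k))) (perms n))

-- Formal power series in x, q with integer coefficients,
-- given by their coefficient functions (x-degree, q-degree)

Series : Set
Series = ℕ → ℕ → ℤ

sumTo : ℕ → (ℕ → ℤ) → ℤ
sumTo zero    f = f 0
sumTo (suc n) f = sumTo n f ℤ.+ f (suc n)

zeroS oneS X Q : Series
zeroS n k = + 0
oneS zero zero = + 1
oneS _    _    = + 0
X (suc zero) zero = + 1
X _          _    = + 0
Q zero (suc zero) = + 1
Q _    _          = + 0

_⊕_ _⊖_ _⊗_ : Series → Series → Series
(f ⊕ g) n k = f n k ℤ.+ g n k
(f ⊖ g) n k = f n k ℤ.- g n k
(f ⊗ g) n k = sumTo n (λ i → sumTo k (λ a → f i a ℤ.* g (n ∸ i) (k ∸ a)))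

infixl 6 _⊕_ _⊖_
infixl 7 _⊗_

F : List ℕ → Series
F τ n k = + Fcoef τ n k

-- W j = x^{(j-1)/2} U_{j-1}(t) with t = (1+x-xq)/(2√x), i.e.
-- W 0 = 0 (= U_{-1}), W 1 = 1, W (j+2) = (1+x-xq) W (j+1) - x W j.
W : ℕ → Series
W zero          = zeroS
W (suc zero)    = oneS
W (suc (suc j)) = (oneS ⊕ X ⊖ X ⊗ Q) ⊗ W (suc j) ⊖ X ⊗ W j

-- numerator and denominator of Corollary 3.6, multiplied by x^{(m-3)/2}
numer denom : ℕ → Series
numer m = (oneS ⊖ X) ⊗ W (m ∸ 2) ⊖ X ⊗ (oneS ⊖ X ⊕ X ⊗ Q) ⊗ W (m ∸ 3)
denom m = (oneS ⊖ X) ⊗ W (m ∸ 1) ⊖ X ⊗ (oneS ⊖ X ⊕ X ⊗ Q) ⊗ W (m ∸ 2)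

module Submission where

open import Defs
open import Data.Nat using (ℕ; _≤_)
open import Relation.Binary.PropositionalEquality using (_≡_)
open import Algebra.Bundles using (CommutativeRing)
open import Data.Nat.Base using (zero; suc; s≤s; z≤n)

-- Every 312-avoiding permutation of {0,…,n} factors uniquely around its
-- minimum 0 as (α + 1) 0 (β + i + 1), with α and β again 312-avoiding and
-- everything before 0 below everything after it. Under this factorisation
-- lis = max (lis α, 1) + lis β, and the permutation avoids m̂ iff α avoids
-- the pattern of m − 1 of the same shape and β avoids m̂ (for m = 2, i.e. the
-- pattern 12: iff α avoids 12 and β is empty). Writing F_m for F_m̂, counting
-- gives F_m = 1 + x (F_{m−1} − 1 + q) F_m, that is F_m (t − x F_{m−1}) = 1 with
-- t = 1 + x − xq. So the F_m are the convergents of a continued fraction, i.e.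
-- ratios of consecutive terms of a solution of D_{j+2} = t D_{j+1} − x D_j;
-- x^{(j−1)/2} U_{j−1}(t/(2√x)) solves this recurrence, and the initial values
-- pin down the stated quotient.

module FormalPowerSeries where

  open import Level using (_⊔_)
  open import Algebra.Solver.Ring.AlmostCommutativeRing
    using (_-Raw-AlmostCommutative⟶_; fromCommutativeRing)
  open import Data.Integer.Base as ℤ using (ℤ; +-*-rawRing)
  open import Data.Nat.Base as ℕ using (ℕ; zero; suc; _∸_; _≤_; z≤n)
  open import Data.Nat.Properties as ℕ
    using (m≤n⇒m≤1+n; ≤-refl; n∸n≡0; +-∸-assoc; m+[n∸m]≡n; +-suc; m∸[m∸n]≡n; m+n∸m≡n; ∸-+-assoc)
  open import Data.Product.Base using (_,_)
  open import Relation.Binary.PropositionalEquality as ≡ using (_≡_)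

  -- The ring solver normalises with integer coefficients through such a morphism.
  _-ℤ-Algebra : ∀ {c ℓ} → CommutativeRing c ℓ → Set (c ⊔ ℓ)
  R -ℤ-Algebra = +-*-rawRing -Raw-AlmostCommutative⟶ fromCommutativeRing R

  module PowerSeries {c ℓ} (R : CommutativeRing c ℓ) (ι : R -ℤ-Algebra) where

    open CommutativeRing R
    open _-Raw-AlmostCommutative⟶_ ι
    open import Algebra.Properties.Ring ring using (-0#≈0#)
    open import Algebra.Properties.CommutativeSemigroup +-commutativeSemigroup using (interchange)
    open import Relation.Binary.Reasoning.Setoid setoid

    ∑ : ℕ → (ℕ → Carrier) → Carrier
    ∑ zero    f = f 0
    ∑ (suc n) f = ∑ n f + f (suc n)

    ∑-cong : ∀ n {f g} → (∀ i → i ≤ n → f i ≈ g i) → ∑ n f ≈ ∑ n g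
    ∑-cong zero    f≈g = f≈g 0 z≤n
    ∑-cong (suc n) f≈g =
      +-cong (∑-cong n (λ i i≤n → f≈g i (m≤n⇒m≤1+n i≤n))) (f≈g (suc n) ≤-refl)

    ∑-distrib-+ : ∀ n f g → ∑ n (λ i → f i + g i) ≈ ∑ n f + ∑ n g
    ∑-distrib-+ zero    f g = refl
    ∑-distrib-+ (suc n) f g = begin
      ∑ n (λ i → f i + g i) + (f (suc n) + g (suc n)) ≈⟨ +-congʳ (∑-distrib-+ n f g) ⟩
      (∑ n f + ∑ n g) + (f (suc n) + g (suc n))       ≈⟨ interchange (∑ n f) (∑ n g) _ _ ⟩
      (∑ n f + f (suc n)) + (∑ n g + g (suc n))       ∎

    *-distribˡ-∑ : ∀ n a f → a * ∑ n f ≈ ∑ n (λ i → a * f i)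
    *-distribˡ-∑ zero    a f = refl
    *-distribˡ-∑ (suc n) a f = trans (distribˡ a _ _) (+-congʳ (*-distribˡ-∑ n a f))

    *-distribʳ-∑ : ∀ n a f → ∑ n f * a ≈ ∑ n (λ i → f i * a)
    *-distribʳ-∑ zero    a f = refl
    *-distribʳ-∑ (suc n) a f = trans (distribʳ a _ _) (+-congʳ (*-distribʳ-∑ n a f))

    ∑-head : ∀ n f → ∑ (suc n) f ≈ f 0 + ∑ n (λ i → f (suc i))
    ∑-head zero    f = refl
    ∑-head (suc n) f = trans (+-congʳ (∑-head n f)) (+-assoc _ _ _)

    ∑-reverse : ∀ n f → ∑ n f ≈ ∑ n (λ i → f (n ∸ i))
    ∑-reverse zero    f = refl
    ∑-reverse (suc n) f = begin
      ∑ n f + f (suc n)                               ≈⟨ +-comm _ _ ⟩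
      f (suc n) + ∑ n f                               ≈⟨ +-congˡ (∑-reverse n f) ⟩
      f (suc n ∸ 0) + ∑ n (λ i → f (suc n ∸ suc i))  ≈⟨ ∑-head n (λ i → f (suc n ∸ i)) ⟨
      ∑ (suc n) (λ i → f (suc n ∸ i))                 ∎

    ∑-head-only : ∀ n f → (∀ i → f (suc i) ≈ 0#) → ∑ n f ≈ f 0
    ∑-head-only zero    f f≈0 = refl
    ∑-head-only (suc n) f f≈0 = trans (+-cong (∑-head-only n f f≈0) (f≈0 n)) (+-identityʳ _)

    ∑-triangle-swap : ∀ n (F : ℕ → ℕ → Carrier) →
      ∑ n (λ i → ∑ i (λ j → F j i)) ≈ ∑ n (λ j → ∑ (n ∸ j) (λ l → F j (j ℕ.+ l)))
    ∑-triangle-swap zero    F = refl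
    ∑-triangle-swap (suc n) F = begin
      ∑ n (λ i → ∑ i (λ j → F j i)) + (∑ n (λ j → F j (suc n)) + F (suc n) (suc n))
        ≈⟨ +-assoc _ _ _ ⟨
      (∑ n (λ i → ∑ i (λ j → F j i)) + ∑ n (λ j → F j (suc n))) + F (suc n) (suc n)
        ≈⟨ +-congʳ (+-congʳ (∑-triangle-swap n F)) ⟩
      (∑ n (λ j → ∑ (n ∸ j) (λ l → F j (j ℕ.+ l))) + ∑ n (λ j → F j (suc n))) + F (suc n) (suc n)
        ≈⟨ +-congʳ (∑-distrib-+ n _ _) ⟨
      ∑ n (λ j → ∑ (n ∸ j) (λ l → F j (j ℕ.+ l)) + F j (suc n)) + F (suc n) (suc n)
        ≈⟨ +-cong (∑-cong n (λ j j≤n → reflexive (extend j j≤n)))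
                  (reflexive (≡.cong (F (suc n)) (≡.sym (ℕ.+-identityʳ (suc n))))) ⟩
      ∑ n (λ j → ∑ (suc n ∸ j) (λ l → F j (j ℕ.+ l))) + F (suc n) (suc n ℕ.+ 0)
        ≡⟨ ≡.cong (λ k → ∑ n (λ j → ∑ (suc n ∸ j) (λ l → F j (j ℕ.+ l)))
                         + ∑ k (λ l → F (suc n) (suc n ℕ.+ l)))
                  (≡.sym (n∸n≡0 (suc n))) ⟩
      ∑ (suc n) (λ j → ∑ (suc n ∸ j) (λ l → F j (j ℕ.+ l))) ∎
      where
      extend : ∀ j → j ≤ n →
        ∑ (n ∸ j) (λ l → F j (j ℕ.+ l)) + F j (suc n) ≡ ∑ (suc n ∸ j) (λ l → F j (j ℕ.+ l))
      extend j j≤n rewrite +-∸-assoc 1 j≤n =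
        ≡.cong (λ k → ∑ (n ∸ j) (λ l → F j (j ℕ.+ l)) + F j k)
          (≡.trans (≡.cong suc (≡.sym (m+[n∸m]≡n j≤n))) (≡.sym (+-suc j (n ∸ j))))

    record _≋_ (f g : ℕ → Carrier) : Set ℓ where
      constructor coefficientwise
      field coefficient : ∀ n → f n ≈ g n
    open _≋_ public

    infix 4 _≋_

    _⊞_ _⊠_ : (ℕ → Carrier) → (ℕ → Carrier) → ℕ → Carrier
    (f ⊞ g) n = f n + g n
    (f ⊠ g) n = ∑ n (λ i → f i * g (n ∸ i))

    ⊟_ : (ℕ → Carrier) → ℕ → Carrier
    (⊟ f) n = - f n

    constant : ℤ → ℕ → Carrier
    constant a zero    = ⟦ a ⟧
    constant a (suc n) = 0#

    constant0≈0 : ∀ n → constant (ℤ.+ 0) n ≈ 0#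
    constant0≈0 zero    = 0-homo
    constant0≈0 (suc n) = refl

    ⊠-comm : ∀ f g n → (f ⊠ g) n ≈ (g ⊠ f) n
    ⊠-comm f g n = begin
      ∑ n (λ i → f i * g (n ∸ i))               ≈⟨ ∑-reverse n _ ⟩
      ∑ n (λ i → f (n ∸ i) * g (n ∸ (n ∸ i)))   ≈⟨ ∑-cong n (λ i i≤n → trans
                                                      (reflexive (≡.cong (λ k → f (n ∸ i) * g k) (m∸[m∸n]≡n i≤n)))
                                                      (*-comm _ _)) ⟩
      ∑ n (λ i → g i * f (n ∸ i))               ∎

    ⊠-assoc : ∀ f g h n → ((f ⊠ g) ⊠ h) n ≈ (f ⊠ (g ⊠ h)) n
    ⊠-assoc f g h n = begin
      ∑ n (λ i → ∑ i (λ j → f j * g (i ∸ j)) * h (n ∸ i))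
        ≈⟨ ∑-cong n (λ i _ → *-distribʳ-∑ i _ _) ⟩
      ∑ n (λ i → ∑ i (λ j → f j * g (i ∸ j) * h (n ∸ i)))
        ≈⟨ ∑-triangle-swap n _ ⟩
      ∑ n (λ j → ∑ (n ∸ j) (λ l → f j * g ((j ℕ.+ l) ∸ j) * h (n ∸ (j ℕ.+ l))))
        ≈⟨ ∑-cong n (λ j _ → ∑-cong (n ∸ j) (λ l _ → trans (*-assoc _ _ _)
             (reflexive (≡.cong₂ (λ u v → f j * (g u * h v)) (m+n∸m≡n j l) (≡.sym (∸-+-assoc n j l)))))) ⟩
      ∑ n (λ j → ∑ (n ∸ j) (λ l → f j * (g l * h ((n ∸ j) ∸ l))))
        ≈⟨ ∑-cong n (λ j _ → *-distribˡ-∑ (n ∸ j) _ _) ⟨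
      ∑ n (λ j → f j * ∑ (n ∸ j) (λ l → g l * h ((n ∸ j) ∸ l))) ∎

    ⊠-identityˡ : ∀ f n → (constant (ℤ.+ 1) ⊠ f) n ≈ f n
    ⊠-identityˡ f n =
      trans (∑-head-only n _ (λ i → zeroˡ _)) (trans (*-congʳ 1-homo) (*-identityˡ _))

    ⊠-distribʳ-⊞ : ∀ h f g n → ((f ⊞ g) ⊠ h) n ≈ ((f ⊠ h) ⊞ (g ⊠ h)) n
    ⊠-distribʳ-⊞ h f g n = trans (∑-cong n (λ i _ → distribʳ _ _ _)) (∑-distrib-+ n _ _)

    open import Algebra.Structures _≋_
      using (IsCommutativeRing)

    ⊞-⊠-isCommutativeRing : IsCommutativeRing _⊞_ _⊠_ ⊟_ (constant (ℤ.+ 0)) (constant (ℤ.+ 1))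
    ⊞-⊠-isCommutativeRing = record
      { isRing = record
        { +-isAbelianGroup = record
          { isGroup = record
            { isMonoid = record
              { isSemigroup = record
                { isMagma = record
                  { isEquivalence = record
                    { refl  = coefficientwise (λ n → refl)
                    ; sym   = λ p → coefficientwise (λ n → sym (coefficient p n))
                    ; trans = λ p q → coefficientwise (λ n → trans (coefficient p n) (coefficient q n))
                    }
                  ; ∙-cong = λ p q → coefficientwise (λ n → +-cong (coefficient p n) (coefficient q n))
                  }
                ; assoc = λ f g h → coefficientwise (λ n → +-assoc _ _ _)
                }
              ; identity =
                  (λ f → coefficientwise (λ n → trans (+-congʳ (constant0≈0 n)) (+-identityˡ _))) ,
                  (λ f → coefficientwise (λ n → trans (+-congˡ (constant0≈0 n)) (+-identityʳ _)))
              }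
            ; inverse =
                (λ f → coefficientwise (λ n → trans (-‿inverseˡ _) (sym (constant0≈0 n)))) ,
                (λ f → coefficientwise (λ n → trans (-‿inverseʳ _) (sym (constant0≈0 n))))
            ; ⁻¹-cong = λ p → coefficientwise (λ n → -‿cong (coefficient p n))
            }
          ; comm = λ f g → coefficientwise (λ n → +-comm _ _)
          }
        ; *-cong = λ p q → coefficientwise (λ n →
            ∑-cong n (λ i _ → *-cong (coefficient p i) (coefficient q (n ∸ i))))
        ; *-assoc = λ f g h → coefficientwise (⊠-assoc f g h)
        ; *-identity =
            (λ f → coefficientwise (⊠-identityˡ f)) ,
            (λ f → coefficientwise (λ n → trans (⊠-comm f _ n) (⊠-identityˡ f n)))
        ; distrib =
            (λ h f g → coefficientwise (λ n → trans (⊠-comm h (f ⊞ g) n)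
               (trans (⊠-distribʳ-⊞ h f g n) (+-cong (⊠-comm f h n) (⊠-comm g h n))))) ,
            (λ h f g → coefficientwise (⊠-distribʳ-⊞ h f g))
        }
      ; *-comm = λ f g → coefficientwise (⊠-comm f g)
      }

    powerSeriesRing : CommutativeRing c ℓ
    powerSeriesRing = record { isCommutativeRing = ⊞-⊠-isCommutativeRing }

    constants : powerSeriesRing -ℤ-Algebra
    constants = record
      { ⟦_⟧    = constant
      ; +-homo = λ a b → coefficientwise λ
          { zero    → +-homo a b
          ; (suc n) → sym (+-identityʳ _) }
      ; *-homo = λ a b → coefficientwise λ
          { zero    → *-homo a b
          ; (suc n) → sym (trans (∑-head-only (suc n) _ (λ i → zeroˡ _)) (zeroʳ _)) }
      ; -‿homo = λ a → coefficientwise λ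
          { zero    → -‿homo a
          ; (suc n) → sym -0#≈0# }
      ; 0-homo = coefficientwise (λ n → refl)
      ; 1-homo = coefficientwise (λ n → refl)
      }

module ContinuedFraction {c ℓ} (R : CommutativeRing c ℓ) where

  open CommutativeRing R
  open import Algebra.Properties.Ring ring using ([y-z]x≈yx-zx)
  open import Algebra.Properties.Group +-group using (//-cong₂)
  open import Relation.Binary.Reasoning.Setoid setoid

  convergent-ratio : ∀ (t x : Carrier) (A D : ℕ → Carrier) →
    (∀ j → A (suc j) * (t - x * A j) ≈ 1#) →
    (∀ j → D (suc (suc j)) ≈ t * D (suc j) - x * D j) →
    A 0 * D 1 ≈ D 0 →
    ∀ j → A j * D (suc j) ≈ D j
  convergent-ratio t x A D A-rec D-rec base zero    = base
  convergent-ratio t x A D A-rec D-rec base (suc j) = begin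
    A (suc j) * D (suc (suc j))                       ≈⟨ *-congˡ (D-rec j) ⟩
    A (suc j) * (t * D (suc j) - x * D j)             ≈⟨ *-congˡ (//-cong₂ refl (*-congˡ ih)) ⟨
    A (suc j) * (t * D (suc j) - x * (A j * D (suc j))) ≈⟨ *-congˡ (//-cong₂ refl (*-assoc x (A j) _)) ⟨
    A (suc j) * (t * D (suc j) - x * A j * D (suc j)) ≈⟨ *-congˡ ([y-z]x≈yx-zx (D (suc j)) t (x * A j)) ⟨
    A (suc j) * ((t - x * A j) * D (suc j))           ≈⟨ *-assoc _ _ _ ⟨
    A (suc j) * (t - x * A j) * D (suc j)             ≈⟨ *-congʳ (A-rec j) ⟩
    1# * D (suc j)                                    ≈⟨ *-identityˡ _ ⟩
    D (suc j)                                         ∎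
    where ih = convergent-ratio t x A D A-rec D-rec base j

module BivariateSeries where

  open FormalPowerSeries

  open import Algebra.Solver.Ring.AlmostCommutativeRing as ACR using ()
  open import Data.Integer.Base as ℤ using (ℤ; +_)
  open import Data.Integer.Properties as ℤ using (+-*-commutativeRing)
  open import Data.Maybe.Base using (Maybe; just; nothing)
  open import Data.Nat.Base as ℕ using (ℕ; zero; suc; _∸_)
  open import Relation.Nullary.Decidable using (yes; no)
  open import Relation.Binary.PropositionalEquality as ≡ using (_≡_)

  ℤ-algebra : +-*-commutativeRing -ℤ-Algebra
  ℤ-algebra = record
    { ⟦_⟧ = λ a → a ; +-homo = λ _ _ → ≡.refl ; *-homo = λ _ _ → ≡.refl
    ; -‿homo = λ _ → ≡.refl ; 0-homo = ≡.refl ; 1-homo = ≡.refl }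

  module ℤ[[q]] = PowerSeries +-*-commutativeRing ℤ-algebra
  module ℤ[[q]][[x]] = PowerSeries ℤ[[q]].powerSeriesRing ℤ[[q]].constants

  open CommutativeRing ℤ[[q]][[x]].powerSeriesRing
  open ACR._-Raw-AlmostCommutative⟶_ ℤ[[q]][[x]].constants using (⟦_⟧)

  private
    ⟦_⟧≟_ : ∀ a b → Maybe (⟦ a ⟧ ≈ ⟦ b ⟧)
    ⟦ a ⟧≟ b with a ℤ.≟ b
    ... | yes ≡.refl = just refl
    ... | no _       = nothing

  open import Algebra.Solver.Ring (CommutativeRing.rawRing +-*-commutativeRing)
    (ACR.fromCommutativeRing ℤ[[q]][[x]].powerSeriesRing) ℤ[[q]][[x]].constants ⟦_⟧≟_
    using (Polynomial; solve; _:=_; _:+_; _:*_; _:-_; con)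

  open import Relation.Binary.Reasoning.Setoid setoid
  open import Algebra.Properties.Group +-group using (//-cong₂; x≈y⇒x∙y⁻¹≈ε)

  ≈⇒coefficients : ∀ {f g : Series} → f ≈ g → ∀ n k → f n k ≡ g n k
  ≈⇒coefficients f≈g n k = ℤ[[q]].coefficient (ℤ[[q]][[x]].coefficient f≈g n) k

  coefficients⇒≈ : ∀ {f g : Series} → (∀ n k → f n k ≡ g n k) → f ≈ g
  coefficients⇒≈ f≡g = ℤ[[q]][[x]].coefficientwise (λ n → ℤ[[q]].coefficientwise (f≡g n))

  sumTo≡∑ : ∀ n f → sumTo n f ≡ ℤ[[q]].∑ n f
  sumTo≡∑ zero    f = ≡.refl
  sumTo≡∑ (suc n) f = ≡.cong (ℤ._+ f (suc n)) (sumTo≡∑ n f)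

  ∑-coefficient : ∀ n (F : ℕ → ℕ → ℤ) k → ℤ[[q]][[x]].∑ n F k ≡ sumTo n (λ i → F i k)
  ∑-coefficient zero    F k = ≡.refl
  ∑-coefficient (suc n) F k = ≡.cong (ℤ._+ F (suc n) k) (∑-coefficient n F k)

  ⊗≈* : ∀ f g → f ⊗ g ≈ f * g
  ⊗≈* f g = coefficients⇒≈ λ n k →
    ≡.sym (≡.trans (∑-coefficient n _ k) (inner-sums n k n))
    where
    inner-sums : ∀ n k m →
      sumTo m (λ i → ℤ[[q]].∑ k (λ a → f i a ℤ.* g (n ∸ i) (k ∸ a))) ≡
      sumTo m (λ i → sumTo k (λ a → f i a ℤ.* g (n ∸ i) (k ∸ a)))
    inner-sums n k zero    = ≡.sym (sumTo≡∑ k _)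
    inner-sums n k (suc m) = ≡.cong₂ ℤ._+_ (inner-sums n k m) (≡.sym (sumTo≡∑ k _))

  oneS≈1# : oneS ≈ 1#
  oneS≈1# = coefficients⇒≈ λ
    { zero zero → ≡.refl ; zero (suc k) → ≡.refl ; (suc n) zero → ≡.refl ; (suc n) (suc k) → ≡.refl }

  zeroS≈0# : zeroS ≈ 0#
  zeroS≈0# = coefficients⇒≈ λ
    { zero zero → ≡.refl ; zero (suc k) → ≡.refl ; (suc n) zero → ≡.refl ; (suc n) (suc k) → ≡.refl }

  private
    0̂ 1̂ : ∀ {n} → Polynomial n
    0̂ = con (+ 0)
    1̂ = con (+ 1)

    t̂ b̂ : ∀ {n} → Polynomial n → Polynomial n → Polynomial n
    t̂ x q = 1̂ :+ x :- x :* q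
    b̂ x q = 1̂ :- x :+ x :* q

  t b : Carrier
  t = 1# + X - X * Q
  b = 1# - X + X * Q

  W-zero : W 0 ≈ 0#
  W-zero = zeroS≈0#

  W-one : W 1 ≈ 1#
  W-one = oneS≈1#

  W-rec : ∀ j → W (suc (suc j)) ≈ t * W (suc j) - X * W j
  W-rec j = //-cong₂
    (trans (⊗≈* (oneS ⊕ X ⊖ X ⊗ Q) (W (suc j)))
           (*-cong (//-cong₂ (+-congʳ oneS≈1#) (⊗≈* X Q)) (refl {W (suc j)})))
    (⊗≈* X (W j))

  b≈ : oneS ⊖ X ⊕ X ⊗ Q ≈ b
  b≈ = +-cong (//-cong₂ oneS≈1# refl) (⊗≈* X Q)

  denom≈ : ∀ m → denom m ≈ (1# - X) * W (m ∸ 1) - X * b * W (m ∸ 2)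
  denom≈ m = //-cong₂
    (trans (⊗≈* (oneS ⊖ X) (W (m ∸ 1))) (*-cong (//-cong₂ oneS≈1# refl) (refl {W (m ∸ 1)})))
    (trans (⊗≈* (X ⊗ (oneS ⊖ X ⊕ X ⊗ Q)) (W (m ∸ 2)))
           (*-cong (trans (⊗≈* X (oneS ⊖ X ⊕ X ⊗ Q)) (*-congˡ {X} b≈)) (refl {W (m ∸ 2)})))

  denom-at : ∀ m {u v} → W (m ∸ 1) ≈ u → W (m ∸ 2) ≈ v → denom m ≈ (1# - X) * u - X * b * v
  denom-at m u≈ v≈ = trans (denom≈ m) (//-cong₂ (*-congˡ {1# - X} u≈) (*-congˡ {X * b} v≈))

  W-two : W 2 ≈ t
  W-two = begin
    W 2              ≈⟨ W-rec 0 ⟩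
    t * W 1 - X * W 0 ≈⟨ //-cong₂ (*-congˡ {t} W-one) (*-congˡ {X} W-zero) ⟩
    t * 1# - X * 0#  ≈⟨ solve 2 (λ x q → t̂ x q :* 1̂ :- x :* 0̂ := t̂ x q) refl X Q ⟩
    t                ∎

  denom-two : denom 2 ≈ 1# - X
  denom-two = trans (denom-at 2 W-one W-zero)
    (solve 2 (λ x q → (1̂ :- x) :* 1̂ :- x :* b̂ x q :* 0̂ := 1̂ :- x) refl X Q)

  denom-three : denom 3 ≈ t * (1# - X) - X * b
  denom-three = trans (denom-at 3 W-two W-one)
    (solve 2 (λ x q → (1̂ :- x) :* t̂ x q :- x :* b̂ x q :* 1̂ := t̂ x q :* (1̂ :- x) :- x :* b̂ x q) refl X Q)

  denom-rec : ∀ j → denom (4 ℕ.+ j) ≈ t * denom (3 ℕ.+ j) - X * denom (2 ℕ.+ j)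
  denom-rec j = begin
    denom (4 ℕ.+ j)
      ≈⟨ denom-at (4 ℕ.+ j) (W-rec (1 ℕ.+ j)) (W-rec j) ⟩
    (1# - X) * (t * W (2 ℕ.+ j) - X * W (1 ℕ.+ j)) - X * b * (t * W (1 ℕ.+ j) - X * W j)
      ≈⟨ solve 5 (λ x q w₂ w₁ w₀ →
           (1̂ :- x) :* (t̂ x q :* w₂ :- x :* w₁) :- x :* b̂ x q :* (t̂ x q :* w₁ :- x :* w₀) :=
           t̂ x q :* ((1̂ :- x) :* w₂ :- x :* b̂ x q :* w₁) :- x :* ((1̂ :- x) :* w₁ :- x :* b̂ x q :* w₀))
           refl X Q (W (2 ℕ.+ j)) (W (1 ℕ.+ j)) (W j) ⟩
    t * ((1# - X) * W (2 ℕ.+ j) - X * b * W (1 ℕ.+ j)) - X * ((1# - X) * W (1 ℕ.+ j) - X * b * W j)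
      ≈⟨ //-cong₂ (*-congˡ {t} (sym (denom≈ (3 ℕ.+ j)))) (*-congˡ {X} (sym (denom≈ (2 ℕ.+ j)))) ⟩
    t * denom (3 ℕ.+ j) - X * denom (2 ℕ.+ j) ∎

  module HatRecurrence
    (A : ℕ → Carrier)
    (A-rec : ∀ j → A (suc j) ≈ 1# + X * ((A j - 1# + Q) * A (suc j)))
    (A-base : A 0 ≈ 1# + X * (A 0 - 1# + Q)) where

    -- b is the value below denom 2 that keeps the three-term recurrence valid
    -- (denom 1 itself is 0).
    D : ℕ → Carrier
    D zero    = b
    D (suc j) = denom (2 ℕ.+ j)

    A-continued-fraction : ∀ j → A (suc j) * (t - X * A j) ≈ 1#
    A-continued-fraction j = begin
      A (suc j) * (t - X * A j)
        ≈⟨ solve 4 (λ a′ a x q →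
             a′ :* (t̂ x q :- x :* a) := 1̂ :+ (a′ :- (1̂ :+ x :* ((a :- 1̂ :+ q) :* a′))))
             refl (A (suc j)) (A j) X Q ⟩
      1# + (A (suc j) - (1# + X * ((A j - 1# + Q) * A (suc j))))
        ≈⟨ +-congˡ {1#} (x≈y⇒x∙y⁻¹≈ε (A-rec j)) ⟩
      1# + 0#
        ≈⟨ +-identityʳ 1# ⟩
      1# ∎

    D-rec : ∀ j → D (suc (suc j)) ≈ t * D (suc j) - X * D j
    D-rec zero    = trans denom-three (//-cong₂ (*-congˡ {t} (sym denom-two)) refl)
    D-rec (suc j) = denom-rec j

    D-base : A 0 * D 1 ≈ D 0
    D-base = begin
      A 0 * denom 2
        ≈⟨ *-congˡ {A 0} denom-two ⟩
      A 0 * (1# - X)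
        ≈⟨ solve 3 (λ a x q → a :* (1̂ :- x) := b̂ x q :+ (a :- (1̂ :+ x :* (a :- 1̂ :+ q)))) refl (A 0) X Q ⟩
      b + (A 0 - (1# + X * (A 0 - 1# + Q)))
        ≈⟨ +-congˡ {b} (x≈y⇒x∙y⁻¹≈ε A-base) ⟩
      b + 0#
        ≈⟨ +-identityʳ b ⟩
      b ∎

    -- numer (3 + j) and denom (2 + j) = D (1 + j) are the same term by computation.
    A*denom≈numer : ∀ j → A (suc j) * denom (3 ℕ.+ j) ≈ numer (3 ℕ.+ j)
    A*denom≈numer j = convergent-ratio t X A D A-continued-fraction D-rec D-base (suc j)
      where open ContinuedFraction ℤ[[q]][[x]].powerSeriesRing

module PatternContainment where

  open import Data.Bool.Base using (true; false; T; _∧_; _∨_; not)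
  open import Data.Bool.Properties using (T-∧; T-∨)
  open import Data.Bool.ListAction using (all)
  open import Data.Empty using (⊥; ⊥-elim)
  open import Data.List.Base using (List; []; _∷_; _++_; [_]; map; length; zip)
  open import Data.List.Properties using (length-++)
  open import Data.List.Membership.Propositional using (_∈_; find; lose)
  import Data.List.Membership.Propositional.Properties as ∈
  open import Data.List.Relation.Binary.Sublist.Propositional
    using (_⊆_; []; _∷_; _∷ʳ_; ⊆-trans)
  open import Data.List.Relation.Binary.Sublist.Propositional.Properties using (map⁺)
  open import Data.List.Relation.Unary.All using (All; []; _∷_)
  import Data.List.Relation.Unary.Any.Properties as Any
  open import Data.List.Relation.Unary.Any using (here)
  open import Data.List.Relation.Unary.AllPairs using (AllPairs; []; _∷_)
  import Data.List.Relation.Unary.All.Properties as All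
  open import Data.Nat.Base using (ℕ; zero; suc; _<_; _<ᵇ_; _+_)
  open import Data.Nat.Properties using (<ᵇ⇒<; <⇒<ᵇ; <-asym; suc-injective; +-cancelʳ-≡)
  open import Data.Product.Base using (∃; ∃₂; _×_; _,_; proj₂)
  open import Data.Sum.Base using (_⊎_; inj₁; inj₂)
  open import Data.Unit.Base using (⊤; tt)
  open import Function.Bundles using (_⇔_; mk⇔; Equivalence)
  open import Function.Properties.Equivalence using () renaming (sym to ⇔-sym; trans to ⇔-trans)
  open import Data.Sum.Function.Propositional using (_⊎-⇔_)
  open import Level using (Level)
  open import Relation.Binary.Core using (Rel)
  open import Relation.Binary.PropositionalEquality using (_≡_; refl; sym; trans; cong; subst)
  open import Relation.Nullary.Negation using (¬_)

  private
    variable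
      ℓ : Level
      R : Rel ℕ ℓ
      x y : ℕ
      w xs ys : List ℕ

  AllPairs-++⁻ : AllPairs R (xs ++ ys) → AllPairs R xs × AllPairs R ys × All (λ x → All (R x) ys) xs
  AllPairs-++⁻ {xs = []}     Rys          = [] , Rys , []
  AllPairs-++⁻ {xs = x ∷ xs} (Rx ∷ Rxsys) with AllPairs-++⁻ {xs = xs} Rxsys
  ... | Rxs , Rys , Rxsys′ = All.++⁻ˡ xs Rx ∷ Rxs , Rys , All.++⁻ʳ xs Rx ∷ Rxsys′

  ⊆-++⁻ : ∀ xs → w ⊆ xs ++ ys → ∃₂ λ w₁ w₂ → w ≡ w₁ ++ w₂ × w₁ ⊆ xs × w₂ ⊆ ys
  ⊆-++⁻ []       w⊆ys = [] , _ , refl , [] , w⊆ys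
  ⊆-++⁻ (x ∷ xs) (.x ∷ʳ w⊆) with ⊆-++⁻ xs w⊆
  ... | w₁ , w₂ , refl , w₁⊆ , w₂⊆ = w₁ , w₂ , refl , x ∷ʳ w₁⊆ , w₂⊆
  ⊆-++⁻ (x ∷ xs) (refl ∷ w⊆) with ⊆-++⁻ xs w⊆
  ... | w₁ , w₂ , refl , w₁⊆ , w₂⊆ = x ∷ w₁ , w₂ , refl , refl ∷ w₁⊆ , w₂⊆

  ⊆-map⁻ : ∀ (f : ℕ → ℕ) xs → w ⊆ map f xs → ∃ λ w′ → w ≡ map f w′ × w′ ⊆ xs
  ⊆-map⁻ f []       []         = [] , refl , []
  ⊆-map⁻ f (x ∷ xs) (_ ∷ʳ w⊆) with ⊆-map⁻ f xs w⊆
  ... | w′ , refl , w′⊆ = w′ , refl , x ∷ʳ w′⊆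
  ⊆-map⁻ f (x ∷ xs) (refl ∷ w⊆) with ⊆-map⁻ f xs w⊆
  ... | w′ , refl , w′⊆ = x ∷ w′ , refl , refl ∷ w′⊆

  ⊆-[x]⁻ : w ⊆ [ x ] → w ≡ [] ⊎ w ≡ [ x ]
  ⊆-[x]⁻ (_ ∷ʳ []) = inj₁ refl
  ⊆-[x]⁻ (refl ∷ []) = inj₂ refl

  ∈-subs⁻ : ∀ σ → w ∈ subs σ → w ⊆ σ
  ∈-subs⁻ []      (here refl) = []
  ∈-subs⁻ (x ∷ σ) w∈ with ∈.∈-++⁻ (map (x ∷_) (subs σ)) w∈
  ... | inj₁ w∈xs with ∈.∈-map⁻ (x ∷_) w∈xs
  ...   | w′ , w′∈ , refl = refl ∷ ∈-subs⁻ σ w′∈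
  ∈-subs⁻ (x ∷ σ) w∈ | inj₂ w∈σ = x ∷ʳ ∈-subs⁻ σ w∈σ

  ∈-subs⁺ : w ⊆ xs → w ∈ subs xs
  ∈-subs⁺ []                       = here refl
  ∈-subs⁺ {xs = x ∷ xs} (_ ∷ʳ w⊆) = ∈.∈-++⁺ʳ (map (x ∷_) (subs xs)) (∈-subs⁺ w⊆)
  ∈-subs⁺ (refl ∷ w⊆)             = ∈.∈-++⁺ˡ (∈.∈-map⁺ _ (∈-subs⁺ w⊆))

  T-injective : ∀ {a b} → (T a ⇔ T b) → a ≡ b
  T-injective {false} {false} _   = refl
  T-injective {false} {true}  a⇔b = ⊥-elim (Equivalence.from a⇔b tt)
  T-injective {true}  {false} a⇔b = ⊥-elim (Equivalence.to a⇔b tt)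
  T-injective {true}  {true}  _   = refl

  T-∨-injective : ∀ {a b c} → (T a ⇔ (T b ⊎ T c)) → a ≡ b ∨ c
  T-∨-injective split = T-injective (⇔-trans split (⇔-sym T-∨))

  ==⇔≡ : ∀ {u v} → T (u == v) ⇔ (u ≡ v)
  ==⇔≡ {true}  {true}  = mk⇔ (λ _ → refl) (λ _ → tt)
  ==⇔≡ {true}  {false} = mk⇔ (λ ()) (λ ())
  ==⇔≡ {false} {true}  = mk⇔ (λ ()) (λ ())
  ==⇔≡ {false} {false} = mk⇔ (λ _ → refl) (λ _ → tt)

  <ᵇ-false : ∀ {m n} → n < m → (m <ᵇ n) ≡ false
  <ᵇ-false {m} {n} n<m with m <ᵇ n in eq
  ... | true  = ⊥-elim (<-asym n<m (<ᵇ⇒< m n (subst T (sym eq) tt)))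
  ... | false = refl

  <ᵇ-true : ∀ {m n} → m < n → (m <ᵇ n) ≡ true
  <ᵇ-true {m} {n} m<n with m <ᵇ n | <⇒<ᵇ m<n
  ... | true | _ = refl

  SameOrder : ℕ → ℕ → ℕ → ℕ → Set
  SameOrder a b x y = (a <ᵇ x) ≡ (b <ᵇ y) × (x <ᵇ a) ≡ (y <ᵇ b)

  SameOrderAll : ℕ → ℕ → List ℕ → List ℕ → Set
  SameOrderAll a b (x ∷ xs) (y ∷ ys) = SameOrder a b x y × SameOrderAll a b xs ys
  SameOrderAll a b _        _        = ⊤

  OrderIso : List ℕ → List ℕ → Set
  OrderIso []       []       = ⊤
  OrderIso (a ∷ as) (b ∷ bs) = SameOrderAll a b as bs × OrderIso as bs
  OrderIso _        _        = ⊥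

  sameOrderAll⇔ : ∀ a b xs ys →
    T (all (λ { (x , y) → ((a <ᵇ x) == (b <ᵇ y)) ∧ ((x <ᵇ a) == (y <ᵇ b)) }) (zip xs ys)) ⇔
    SameOrderAll a b xs ys
  sameOrderAll⇔ a b xs ys = mk⇔ (to xs ys) (from xs ys)
    where
    to : ∀ xs ys → T (all _ (zip xs ys)) → SameOrderAll a b xs ys
    to []       _        _ = tt
    to (x ∷ xs) []       _ = tt
    to (x ∷ xs) (y ∷ ys) t with Equivalence.to T-∧ t
    ... | t₁ , t₂ with Equivalence.to T-∧ t₁
    ...   | u₁ , u₂ = (Equivalence.to ==⇔≡ u₁ , Equivalence.to ==⇔≡ u₂) , to xs ys t₂
    from : ∀ xs ys → SameOrderAll a b xs ys → T (all _ (zip xs ys))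
    from []       _        _ = tt
    from (x ∷ xs) []       _ = tt
    from (x ∷ xs) (y ∷ ys) ((e₁ , e₂) , s) = Equivalence.from T-∧
      (Equivalence.from T-∧ (Equivalence.from ==⇔≡ e₁ , Equivalence.from ==⇔≡ e₂) , from xs ys s)

  orderIso⇔ : ∀ τ w → T (orderIso τ w) ⇔ OrderIso τ w
  orderIso⇔ τ w = mk⇔ (to τ w) (from τ w)
    where
    to : ∀ τ w → T (orderIso τ w) → OrderIso τ w
    to []      []      _ = tt
    to (a ∷ τ) (b ∷ w) t with Equivalence.to T-∧ t
    ... | t₁ , t₂ = Equivalence.to (sameOrderAll⇔ a b τ w) t₁ , to τ w t₂
    from : ∀ τ w → OrderIso τ w → T (orderIso τ w)
    from []      []      _       = tt
    from (a ∷ τ) (b ∷ w) (s , o) = Equivalence.from T-∧ (Equivalence.from (sameOrderAll⇔ a b τ w) s , from τ w o)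

  OrderIso-length : ∀ τ w → OrderIso τ w → length τ ≡ length w
  OrderIso-length []      []      _       = refl
  OrderIso-length (a ∷ τ) (b ∷ w) (_ , o) = cong suc (OrderIso-length τ w o)

  OrderIso-sym : ∀ τ w → OrderIso τ w → OrderIso w τ
  OrderIso-sym []      []      _       = tt
  OrderIso-sym (a ∷ τ) (b ∷ w) (s , o) = sym-all τ w s , OrderIso-sym τ w o
    where
    sym-all : ∀ xs ys → SameOrderAll a b xs ys → SameOrderAll b a ys xs
    sym-all (x ∷ xs) (y ∷ ys) ((e₁ , e₂) , s) = (sym e₁ , sym e₂) , sym-all xs ys s
    sym-all []       []       _ = tt
    sym-all []       (y ∷ ys) _ = tt
    sym-all (x ∷ xs) []       _ = tt

  OrderIso-[]ʳ : ∀ τ x → OrderIso (τ ++ [ x ]) [] → ⊥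
  OrderIso-[]ʳ []      x ()
  OrderIso-[]ʳ (_ ∷ _) x ()

  OrderIso-[]ˡ : ∀ w y → OrderIso [] (w ++ [ y ]) → ⊥
  OrderIso-[]ˡ []      y ()
  OrderIso-[]ˡ (_ ∷ _) y ()

  OrderPreserving : (ℕ → ℕ) → Set
  OrderPreserving f = ∀ x y → (f x <ᵇ f y) ≡ (x <ᵇ y)

  suc-orderPreserving : OrderPreserving suc
  suc-orderPreserving x y = refl

  +-orderPreserving : ∀ c → OrderPreserving (c +_)
  +-orderPreserving zero    x y = refl
  +-orderPreserving (suc c) x y = +-orderPreserving c x y

  module _ {f : ℕ → ℕ} (f-mono : OrderPreserving f) where

    OrderIso-map⁺ : ∀ τ w → OrderIso τ w → OrderIso τ (map f w)
    OrderIso-map⁺ []      []      _       = tt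
    OrderIso-map⁺ (a ∷ τ) (b ∷ w) (s , o) = all⁺ τ w s , OrderIso-map⁺ τ w o
      where
      all⁺ : ∀ xs ys → SameOrderAll a b xs ys → SameOrderAll a (f b) xs (map f ys)
      all⁺ (x ∷ xs) (y ∷ ys) ((e₁ , e₂) , s) =
        (trans e₁ (sym (f-mono b y)) , trans e₂ (sym (f-mono y b))) , all⁺ xs ys s
      all⁺ []       _        _ = tt
      all⁺ (x ∷ xs) []       _ = tt

    OrderIso-map⁻ : ∀ τ w → OrderIso τ (map f w) → OrderIso τ w
    OrderIso-map⁻ []      []      _       = tt
    OrderIso-map⁻ (a ∷ τ) (b ∷ w) (s , o) = all⁻ τ w s , OrderIso-map⁻ τ w o
      where
      all⁻ : ∀ xs ys → SameOrderAll a (f b) xs (map f ys) → SameOrderAll a b xs ys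
      all⁻ (x ∷ xs) (y ∷ ys) ((e₁ , e₂) , s) = (trans e₁ (f-mono b y) , trans e₂ (f-mono y b)) , all⁻ xs ys s
      all⁻ []       _        _ = tt
      all⁻ (x ∷ xs) []       _ = tt

    OrderIso-mapˡ⁺ : ∀ τ w → OrderIso τ w → OrderIso (map f τ) w
    OrderIso-mapˡ⁺ τ w o = OrderIso-sym w (map f τ) (OrderIso-map⁺ w τ (OrderIso-sym τ w o))

    OrderIso-mapˡ⁻ : ∀ τ w → OrderIso (map f τ) w → OrderIso τ w
    OrderIso-mapˡ⁻ τ w o = OrderIso-sym w τ (OrderIso-map⁻ w τ (OrderIso-sym (map f τ) w o))

  OrderIso-∷ʳ⁻ : ∀ τ w x y → OrderIso (τ ++ [ x ]) (w ++ [ y ]) → OrderIso τ w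
  OrderIso-∷ʳ⁻ []          []          x y _       = tt
  OrderIso-∷ʳ⁻ []          (b ∷ [])    x y (_ , ())
  OrderIso-∷ʳ⁻ []          (b ∷ _ ∷ _) x y (_ , ())
  OrderIso-∷ʳ⁻ (a ∷ [])    []          x y (_ , ())
  OrderIso-∷ʳ⁻ (a ∷ _ ∷ _) []          x y (_ , ())
  OrderIso-∷ʳ⁻ (a ∷ τ)     (b ∷ w)     x y (s , o) = init-all τ w s , OrderIso-∷ʳ⁻ τ w x y o
    where
    init-all : ∀ xs ys → SameOrderAll a b (xs ++ [ x ]) (ys ++ [ y ]) → SameOrderAll a b xs ys
    init-all []        _         _       = tt
    init-all (x′ ∷ xs) []        _       = tt
    init-all (x′ ∷ xs) (y′ ∷ ys) (e , s) = e , init-all xs ys s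

  OrderIso-∷ʳ⁺ : ∀ τ w x y → OrderIso τ w → All (x <_) τ → All (y <_) w → OrderIso (τ ++ [ x ]) (w ++ [ y ])
  OrderIso-∷ʳ⁺ []      []      x y _       _          _          = tt , tt
  OrderIso-∷ʳ⁺ (a ∷ τ) (b ∷ w) x y (s , o) (x<a ∷ x<τ) (y<b ∷ y<w) =
    snoc-all τ w (OrderIso-length τ w o) s , OrderIso-∷ʳ⁺ τ w x y o x<τ y<w
    where
    snoc-all : ∀ xs ys → length xs ≡ length ys → SameOrderAll a b xs ys →
               SameOrderAll a b (xs ++ [ x ]) (ys ++ [ y ])
    snoc-all []        []        _  _       =
      (trans (<ᵇ-false x<a) (sym (<ᵇ-false y<b)) , trans (<ᵇ-true x<a) (sym (<ᵇ-true y<b))) , tt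
    snoc-all (x′ ∷ xs) (y′ ∷ ys) eq (e , s) = e , snoc-all xs ys (suc-injective eq) s

  OrderIso-last<head : ∀ a b τ w x y → OrderIso (a ∷ τ ++ [ x ]) (b ∷ w ++ [ y ]) → x < a → y < b
  OrderIso-last<head a b τ w x y (s , o) x<a =
    <ᵇ⇒< y b (subst T (proj₂ (last-order τ w same-length s)) (<⇒<ᵇ x<a))
    where
    same-length : length τ ≡ length w
    same-length = +-cancelʳ-≡ _ _ _
      (trans (sym (length-++ τ)) (trans (OrderIso-length _ _ o) (length-++ w)))
    last-order : ∀ xs ys → length xs ≡ length ys →
                 SameOrderAll a b (xs ++ [ x ]) (ys ++ [ y ]) → SameOrder a b x y
    last-order []        []        _  (e , _) = e
    last-order (x′ ∷ xs) (y′ ∷ ys) eq (_ , s) = last-order xs ys (suc-injective eq) s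

  Contains : List ℕ → List ℕ → Set
  Contains τ σ = ∃ λ w → w ⊆ σ × OrderIso τ w

  contains⇔ : ∀ τ σ → T (contains τ σ) ⇔ Contains τ σ
  contains⇔ τ σ = mk⇔ to from
    where
    to : T (contains τ σ) → Contains τ σ
    to c with find (Any.any⁻ (orderIso τ) (subs σ) c)
    ... | w , w∈ , o = w , ∈-subs⁻ σ w∈ , Equivalence.to (orderIso⇔ τ w) o
    from : Contains τ σ → T (contains τ σ)
    from (w , w⊆σ , o) = Any.any⁺ (orderIso τ) (lose (∈-subs⁺ w⊆σ) (Equivalence.from (orderIso⇔ τ w) o))

  avoids≡not-contains : ∀ τ σ → avoids τ σ ≡ not (contains τ σ)
  avoids≡not-contains τ σ with contains τ σ
  ... | true  = refl
  ... | false = refl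

  Contains-mono : ∀ τ {σ σ′} → σ ⊆ σ′ → Contains τ σ → Contains τ σ′
  Contains-mono τ σ⊆σ′ (w , w⊆σ , o) = w , ⊆-trans w⊆σ σ⊆σ′ , o

  contains-map : ∀ {f} → OrderPreserving f → ∀ τ σ → contains τ (map f σ) ≡ contains τ σ
  contains-map {f} f-mono τ σ = T-injective (mk⇔
    (λ c → Equivalence.from (contains⇔ τ σ) (unmap (Equivalence.to (contains⇔ τ _) c)))
    (λ c → Equivalence.from (contains⇔ τ _) (remap (Equivalence.to (contains⇔ τ σ) c))))
    where
    unmap : Contains τ (map f σ) → Contains τ σ
    unmap (w , w⊆ , o) with ⊆-map⁻ f σ w⊆
    ... | w′ , refl , w′⊆σ = w′ , w′⊆σ , OrderIso-map⁻ f-mono τ w′ o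
    remap : Contains τ σ → Contains τ (map f σ)
    remap (w , w⊆σ , o) = map f w , map⁺ f w⊆σ , OrderIso-map⁺ f-mono τ w o

  avoids⇒¬Contains : ∀ τ σ → T (avoids τ σ) → ¬ Contains τ σ
  avoids⇒¬Contains τ σ av occ with contains τ σ | Equivalence.from (contains⇔ τ σ) occ
  ... | true  | _  = av
  ... | false | ()

  contains-∨ : ∀ τ σ τ₁ σ₁ τ₂ σ₂ → (Contains τ σ ⇔ (Contains τ₁ σ₁ ⊎ Contains τ₂ σ₂)) →
    contains τ σ ≡ contains τ₁ σ₁ ∨ contains τ₂ σ₂
  contains-∨ τ σ τ₁ σ₁ τ₂ σ₂ split = T-∨-injective
    (⇔-trans (contains⇔ τ σ) (⇔-trans split (⇔-sym (contains⇔ τ₁ σ₁ ⊎-⇔ contains⇔ τ₂ σ₂))))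

module IncreasingSubsequences where

  open PatternContainment
  open import Data.Bool.Base using (T; _∧_; _∨_; not)
  open import Data.Bool.Properties using (T-∧)
  open import Data.List.Base using (List; []; _∷_; _++_; [_]; map; length; filter; foldr; null; initLast; _∷ʳ′_)
  open import Data.List.Properties using (length-++; length-map; ++-assoc; ++-identityʳ)
  open import Data.List.Membership.Propositional using (_∈_)
  import Data.List.Membership.Propositional.Properties as ∈
  open import Data.List.Relation.Binary.Sublist.Propositional
    using (_⊆_; []; _∷_; _∷ʳ_; minimum; ⊆-refl; ⊆-trans)
  open import Data.List.Relation.Binary.Sublist.Propositional.Properties
    using (++⁺; ++⁺ˡ; ++⁺ʳ; map⁺; All-resp-⊆; Any-resp-⊆)
  open import Data.List.Relation.Unary.All as All using (All; []; _∷_)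
  import Data.List.Relation.Unary.All.Properties as AllP
  open import Data.List.Relation.Unary.Any using (here; there)
  open import Data.List.Relation.Unary.AllPairs as AllPairs using (AllPairs; []; _∷_)
  import Data.List.Relation.Unary.AllPairs.Properties as AllPairs
  open import Data.Nat.Base using (ℕ; suc; _+_; _≤_; _<_; _⊔_; s≤s; z≤n)
  open import Data.Nat.Properties
    using (<ᵇ⇒<; <⇒<ᵇ; <-trans; <-asym; ≤-trans; ≤-antisym; m≤m⊔n; m≤n⊔m; ⊔-sel; +-mono-≤)
  open import Data.Product.Base using (∃; _×_; _,_; proj₁; proj₂)
  open import Data.Sum.Base using (_⊎_; inj₁; inj₂)
  open import Data.Unit.Base using (tt)
  open import Data.Empty using (⊥; ⊥-elim)
  open import Function.Bundles using (mk⇔; Equivalence)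
  open import Function.Properties.Equivalence using () renaming (refl to ⇔-refl; sym to ⇔-sym; trans to ⇔-trans)
  open import Data.Sum.Function.Propositional using (_⊎-⇔_)
  open import Relation.Nullary.Decidable using (T?)
  open import Relation.Binary.PropositionalEquality using (_≡_; refl; sym; trans; cong₂; subst)

  Increasing : List ℕ → Set
  Increasing = AllPairs _<_

  Increasing-∷ : ∀ {x y ys} → x < y → Increasing (y ∷ ys) → Increasing (x ∷ y ∷ ys)
  Increasing-∷ x<y inc = (x<y ∷ All.map (<-trans x<y) (AllPairs.head inc)) ∷ inc

  Increasing-++⁻ : ∀ xs {ys} → Increasing (xs ++ ys) →
    Increasing xs × Increasing ys × All (λ x → All (x <_) ys) xs
  Increasing-++⁻ xs = AllPairs-++⁻ {xs = xs}

  increasing⁻ : ∀ w → T (increasing w) → Increasing w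
  increasing⁻ []           _ = []
  increasing⁻ (x ∷ [])     _ = [] ∷ []
  increasing⁻ (x ∷ y ∷ ys) t = Increasing-∷ (<ᵇ⇒< x y (proj₁ (Equivalence.to T-∧ t)))
                                            (increasing⁻ (y ∷ ys) (proj₂ (Equivalence.to T-∧ t)))

  increasing⁺ : ∀ w → Increasing w → T (increasing w)
  increasing⁺ []           _                  = tt
  increasing⁺ (x ∷ [])     _                  = tt
  increasing⁺ (x ∷ y ∷ ys) ((x<y ∷ _) ∷ rest) = Equivalence.from T-∧ (<⇒<ᵇ x<y , increasing⁺ (y ∷ ys) rest)

  increasing-map : ∀ {f} → OrderPreserving f → ∀ w → increasing (map f w) ≡ increasing w
  increasing-map f-mono []           = refl
  increasing-map f-mono (x ∷ [])     = refl
  increasing-map f-mono (x ∷ y ∷ ys) = cong₂ _∧_ (f-mono x y) (increasing-map f-mono (y ∷ ys))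

  foldr-⊔-upper : ∀ {x} xs → x ∈ xs → x ≤ foldr _⊔_ 0 xs
  foldr-⊔-upper (y ∷ xs) (here refl) = m≤m⊔n y _
  foldr-⊔-upper (y ∷ xs) (there x∈) = ≤-trans (foldr-⊔-upper xs x∈) (m≤n⊔m y _)

  foldr-⊔-sel : ∀ xs → foldr _⊔_ 0 xs ≡ 0 ⊎ foldr _⊔_ 0 xs ∈ xs
  foldr-⊔-sel []       = inj₁ refl
  foldr-⊔-sel (y ∷ xs) with ⊔-sel y (foldr _⊔_ 0 xs)
  ... | inj₁ eq = inj₂ (here eq)
  ... | inj₂ eq with foldr-⊔-sel xs
  ...   | inj₁ eq′ = inj₁ (trans eq eq′)
  ...   | inj₂ m∈  = inj₂ (there (subst (_∈ xs) (sym eq) m∈))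

  lis-upper : ∀ {w σ} → w ⊆ σ → Increasing w → length w ≤ lis σ
  lis-upper {w} {σ} w⊆σ inc = foldr-⊔-upper _
    (∈.∈-map⁺ length (∈.∈-filter⁺ (λ w → T? (increasing w)) (∈-subs⁺ w⊆σ)
      (increasing⁺ w inc)))

  lis-attained : ∀ σ → ∃ λ w → w ⊆ σ × Increasing w × length w ≡ lis σ
  lis-attained σ with foldr-⊔-sel (map length (filter (λ w → T? (increasing w)) (subs σ)))
  ... | inj₁ eq = [] , minimum σ , [] , sym eq
  ... | inj₂ m∈ with ∈.∈-map⁻ length m∈
  ...   | w , w∈ , eq with ∈.∈-filter⁻ (λ w → T? (increasing w)) w∈
  ...     | w∈subs , inc = w , ∈-subs⁻ σ w∈subs , increasing⁻ w inc , sym eq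

  lis-map : ∀ {f} → OrderPreserving f → ∀ σ → lis (map f σ) ≡ lis σ
  lis-map {f} f-mono σ = ≤-antisym ≤lis ≥lis
    where
    ≤lis : lis (map f σ) ≤ lis σ
    ≤lis with lis-attained (map f σ)
    ... | w , w⊆ , inc , eq with ⊆-map⁻ f σ w⊆
    ...   | w′ , refl , w′⊆σ = subst (_≤ lis σ) (trans (sym (length-map f w′)) eq)
      (lis-upper w′⊆σ (increasing⁻ w′
        (subst T (increasing-map f-mono w′) (increasing⁺ (map f w′) inc))))
    ≥lis : lis σ ≤ lis (map f σ)
    ≥lis with lis-attained σ
    ... | w , w⊆σ , inc , eq = subst (_≤ lis (map f σ)) (trans (length-map f w) eq)
      (lis-upper (map⁺ f w⊆σ) (increasing⁻ (map f w)
        (subst T (sym (increasing-map f-mono w)) (increasing⁺ w inc))))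

  module MinimumBetween (A B : List ℕ) (c : ℕ)
    (c<A : All (c <_) A) (c<B : All (c <_) B) (A<B : All (λ a → All (a <_) B) A) where

    σ : List ℕ
    σ = A ++ c ∷ B

    lis-split : lis σ ≡ (lis A ⊔ 1) + lis B
    lis-split = ≤-antisym ≤split ≥split
      where
      ≤split : lis σ ≤ (lis A ⊔ 1) + lis B
      ≤split with lis-attained σ
      ... | w , w⊆σ , inc , eq with ⊆-++⁻ A w⊆σ
      ...   | w₁ , w₂ , refl , w₁⊆A , (_ ∷ʳ w₂⊆B) with Increasing-++⁻ w₁ inc
      ...     | inc₁ , inc₂ , _ = subst (_≤ (lis A ⊔ 1) + lis B) (trans (sym (length-++ w₁)) eq)
        (+-mono-≤ (≤-trans (lis-upper w₁⊆A inc₁) (m≤m⊔n _ 1)) (lis-upper w₂⊆B inc₂))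
      ≤split | w , w⊆σ , inc , eq | [] , _ ∷ w₃ , refl , _ , (refl ∷ w₃⊆B) =
        subst (_≤ (lis A ⊔ 1) + lis B) eq (+-mono-≤ (m≤n⊔m (lis A) 1) (lis-upper w₃⊆B (AllPairs.tail inc)))
      ≤split | w , w⊆σ , inc , eq | x ∷ w₁ , _ ∷ w₃ , refl , w₁⊆A , (refl ∷ _) =
        ⊥-elim (<-asym x<c (All.lookup c<A (Any-resp-⊆ w₁⊆A (here refl))))
        where
        x<c : x < c
        x<c = All.head (All.head (proj₂ (proj₂ (Increasing-++⁻ (x ∷ w₁) inc))))
      ≥split : (lis A ⊔ 1) + lis B ≤ lis σ
      ≥split with lis-attained B | ⊔-sel (lis A) 1
      ... | wB , wB⊆B , incB , eqB | inj₂ eq₁ =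
        subst (_≤ lis σ) (cong₂ _+_ (sym eq₁) eqB)
          (lis-upper (++⁺ˡ A (refl ∷ wB⊆B)) (All-resp-⊆ wB⊆B c<B ∷ incB))
      ... | wB , wB⊆B , incB , eqB | inj₁ eq₁ with lis-attained A
      ...   | wA , wA⊆A , incA , eqA =
        subst (_≤ lis σ) (trans (length-++ wA) (cong₂ _+_ (trans eqA (sym eq₁)) eqB))
          (lis-upper (++⁺ wA⊆A (c ∷ʳ wB⊆B))
            (AllPairs.++⁺ incA incB (All.map (All-resp-⊆ wB⊆B) (All-resp-⊆ wA⊆A A<B))))

    A⊆σ : A ⊆ σ
    A⊆σ = ++⁺ʳ (c ∷ B) ⊆-refl

    A∷ʳc⊆σ : A ++ [ c ] ⊆ σ
    A∷ʳc⊆σ = ++⁺ ⊆-refl (refl ∷ minimum B)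

    B⊆σ : B ⊆ σ
    B⊆σ = ++⁺ˡ A (c ∷ʳ ⊆-refl)

    A∷ʳc<B : ∀ {u y} → u ∈ A ++ [ c ] → y ∈ B → u < y
    A∷ʳc<B u∈ y∈ with ∈.∈-++⁻ A u∈
    ... | inj₁ u∈A          = All.lookup (All.lookup A<B u∈A) y∈
    ... | inj₂ (here refl) = All.lookup c<B y∈

    -- An occurrence that ends below its first entry cannot start in A ++ [ c ] and end in B.
    Contains-split : ∀ t τ x → x < t → Contains (t ∷ τ ++ [ x ]) σ →
      Contains (t ∷ τ ++ [ x ]) (A ++ [ c ]) ⊎ Contains (t ∷ τ ++ [ x ]) B
    Contains-split t τ x x<t (w , w⊆σ , o) with ⊆-++⁻ (A ++ [ c ]) (subst (w ⊆_) (sym (++-assoc A [ c ] B)) w⊆σ)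
    ... | w₁ , [] , refl , w₁⊆ , _ = inj₁ (w₁ , w₁⊆ , subst (OrderIso _) (++-identityʳ w₁) o)
    ... | [] , w₂ , refl , _ , w₂⊆B = inj₂ (w₂ , w₂⊆B , o)
    ... | u ∷ w₁ , w₂ , refl , w₁⊆ , w₂⊆B with initLast w₂
    ...   | []       = inj₁ (u ∷ w₁ , w₁⊆ , subst (OrderIso _) (++-identityʳ (u ∷ w₁)) o)
    ...   | ys ∷ʳ′ y = ⊥-elim (<-asym y<u (A∷ʳc<B (Any-resp-⊆ w₁⊆ (here refl)) y∈B))
      where
      y∈B : y ∈ B
      y∈B = Any-resp-⊆ w₂⊆B (∈.∈-++⁺ʳ ys (here refl))
      y<u : y < u
      y<u = OrderIso-last<head t u τ (w₁ ++ ys) x y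
        (subst (λ v → OrderIso (t ∷ τ ++ [ x ]) (u ∷ v)) (sym (++-assoc w₁ ys [ y ])) o) x<t

    Contains-suc-∷ʳ-1⁻ : ∀ τ → Contains (map suc τ ++ [ 1 ]) (A ++ [ c ]) → Contains τ A
    Contains-suc-∷ʳ-1⁻ τ (w , w⊆ , o) with ⊆-++⁻ A w⊆
    ... | w₁ , w₂ , refl , w₁⊆A , w₂⊆c with ⊆-[x]⁻ w₂⊆c
    ...   | inj₂ refl = w₁ , w₁⊆A , OrderIso-mapˡ⁻ suc-orderPreserving τ w₁ (OrderIso-∷ʳ⁻ _ w₁ 1 c o)
    ...   | inj₁ refl with initLast w₁
    ...     | []       = ⊥-elim (OrderIso-[]ʳ (map suc τ) 1 o)
    ...     | ys ∷ʳ′ y = ys , ⊆-trans (++⁺ʳ [ y ] ⊆-refl) w₁⊆A ,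
      OrderIso-mapˡ⁻ suc-orderPreserving τ ys (OrderIso-∷ʳ⁻ _ ys 1 y (subst (OrderIso _) (++-identityʳ _) o))

    Contains-suc-∷ʳ-1⁺ : ∀ τ → All (0 <_) τ → Contains τ A → Contains (map suc τ ++ [ 1 ]) (A ++ [ c ])
    Contains-suc-∷ʳ-1⁺ τ 0<τ (w , w⊆A , o) = w ++ [ c ] , ++⁺ w⊆A ⊆-refl ,
      OrderIso-∷ʳ⁺ (map suc τ) w 1 c (OrderIso-mapˡ⁺ suc-orderPreserving τ w o)
        (AllP.map⁺ (All.map s≤s 0<τ)) (All-resp-⊆ w⊆A c<A)

    contains-suc-∷ʳ-1 : ∀ a τ′ → All (0 <_) (a ∷ τ′) →
      contains (map suc (a ∷ τ′) ++ [ 1 ]) σ ≡ contains (a ∷ τ′) A ∨ contains (map suc (a ∷ τ′) ++ [ 1 ]) B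
    contains-suc-∷ʳ-1 a τ′ 0<τ@(0<a ∷ _) = contains-∨ _ σ τ A _ B (mk⇔ to from)
      where
      τ : List ℕ
      τ = a ∷ τ′
      to : Contains (map suc τ ++ [ 1 ]) σ → Contains τ A ⊎ Contains (map suc τ ++ [ 1 ]) B
      to occ with Contains-split (suc a) (map suc τ′) 1 (s≤s 0<a) occ
      ... | inj₁ occ′ = inj₁ (Contains-suc-∷ʳ-1⁻ τ occ′)
      ... | inj₂ occ′ = inj₂ occ′
      from : Contains τ A ⊎ Contains (map suc τ ++ [ 1 ]) B → Contains (map suc τ ++ [ 1 ]) σ
      from (inj₁ occ) = Contains-mono _ A∷ʳc⊆σ (Contains-suc-∷ʳ-1⁺ τ 0<τ occ)
      from (inj₂ occ) = Contains-mono _ B⊆σ occ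

    Contains-312-∷ʳ-c⁻ : Contains p312 (A ++ [ c ]) → Contains p312 A
    Contains-312-∷ʳ-c⁻ (w , w⊆ , o) with ⊆-++⁻ A w⊆
    ... | w₁ , w₂ , refl , w₁⊆A , w₂⊆c with ⊆-[x]⁻ w₂⊆c
    ...   | inj₁ refl = w₁ , w₁⊆A , subst (OrderIso p312) (++-identityʳ w₁) o
    ...   | inj₂ refl = ⊥-elim (c-not-last w₁ w₁⊆A o)
      where
      c-not-last : ∀ w₁ → w₁ ⊆ A → OrderIso p312 (w₁ ++ [ c ]) → ⊥
      c-not-last (u ∷ v ∷ []) w₁⊆A (_ , ((v<ᵇc , _) , _) , _) =
        <-asym (<ᵇ⇒< v c (subst T v<ᵇc tt)) (All.lookup (All-resp-⊆ w₁⊆A c<A) (there (here refl)))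
      c-not-last (u ∷ v ∷ _ ∷ w₁) _ (_ , _ , _ , o′) = OrderIso-[]ˡ w₁ c o′

    contains-312 : contains p312 σ ≡ contains p312 A ∨ contains p312 B
    contains-312 = contains-∨ p312 σ p312 A p312 B (mk⇔ to from)
      where
      to : Contains p312 σ → Contains p312 A ⊎ Contains p312 B
      to occ with Contains-split 3 [ 1 ] 2 (s≤s (s≤s (s≤s z≤n))) occ
      ... | inj₁ occ′ = inj₁ (Contains-312-∷ʳ-c⁻ occ′)
      ... | inj₂ occ′ = inj₂ occ′
      from : Contains p312 A ⊎ Contains p312 B → Contains p312 σ
      from (inj₁ occ) = Contains-mono p312 A⊆σ occ
      from (inj₂ occ) = Contains-mono p312 B⊆σ occ

    Contains-12-∷ʳ-c⁻ : Contains (hat 2) (A ++ [ c ]) → Contains (hat 2) A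
    Contains-12-∷ʳ-c⁻ (w , w⊆ , o) with ⊆-++⁻ A w⊆
    ... | w₁ , w₂ , refl , w₁⊆A , w₂⊆c with ⊆-[x]⁻ w₂⊆c
    ...   | inj₁ refl = w₁ , w₁⊆A , subst (OrderIso (hat 2)) (++-identityʳ w₁) o
    ...   | inj₂ refl = ⊥-elim (c-not-last w₁ w₁⊆A o)
      where
      c-not-last : ∀ w₁ → w₁ ⊆ A → OrderIso (hat 2) (w₁ ++ [ c ]) → ⊥
      c-not-last (u ∷ []) w₁⊆A (((u<ᵇc , _) , _) , _) =
        <-asym (<ᵇ⇒< u c (subst T u<ᵇc tt)) (All.head (All-resp-⊆ w₁⊆A c<A))
      c-not-last (u ∷ _ ∷ w₁) _ (_ , _ , o′) = OrderIso-[]ˡ w₁ c o′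

    contains-12 : contains (hat 2) σ ≡ contains (hat 2) A ∨ not (null B)
    contains-12 = T-∨-injective
      (⇔-trans (contains⇔ (hat 2) σ) (⇔-trans (mk⇔ to from) (⇔-sym (contains⇔ (hat 2) A ⊎-⇔ ⇔-refl))))
      where
      to : Contains (hat 2) σ → Contains (hat 2) A ⊎ T (not (null B))
      to (w , w⊆σ , o) with ⊆-++⁻ (A ++ [ c ]) (subst (w ⊆_) (sym (++-assoc A [ c ] B)) w⊆σ)
      ... | w₁ , [] , refl , w₁⊆ , _ =
        inj₁ (Contains-12-∷ʳ-c⁻ (w₁ , w₁⊆ , subst (OrderIso _) (++-identityʳ w₁) o))
      ... | w₁ , v ∷ w₂ , refl , _ , v∷w₂⊆B = inj₂ (non-null (Any-resp-⊆ v∷w₂⊆B (here refl)))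
        where
        non-null : ∀ {B} → v ∈ B → T (not (null B))
        non-null (here _)  = tt
        non-null (there _) = tt
      from : Contains (hat 2) A ⊎ T (not (null B)) → Contains (hat 2) σ
      from (inj₁ occ) = Contains-mono (hat 2) A⊆σ occ
      from (inj₂ B≢[]) = pair-with-c B ⊆-refl c<B B≢[]
        where
        pair-with-c : ∀ B′ → B′ ⊆ B → All (c <_) B′ → T (not (null B′)) → Contains (hat 2) σ
        pair-with-c (b ∷ _) B′⊆B (c<b ∷ _) _ =
          c ∷ b ∷ [] , ++⁺ˡ A (refl ∷ ⊆-trans (refl ∷ minimum _) B′⊆B) ,
          ((sym (<ᵇ-true c<b) , sym (<ᵇ-false c<b)) , tt) , (tt , tt)

module Building where

  open PatternContainment
  open IncreasingSubsequences
  open import Data.Bool.Base using (true; false; _∧_; _∨_; not)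
  open import Data.Bool.Properties using (not-involutive)
  open import Data.List.Base using (List; []; _∷_; _++_; [_]; map; null)
  open import Data.List.Relation.Unary.All as All using (All; []; _∷_)
  import Data.List.Relation.Unary.All.Properties as AllP
  open import Data.Nat.Base using (ℕ; zero; suc; _+_; _<_; _⊔_; s≤s; z≤n)
  open import Data.Nat.Properties using (≤-trans; m≤m+n)
  open import Relation.Binary.PropositionalEquality as ≡ using (_≡_; refl; sym; trans; cong; cong₂)
  open ≡.≡-Reasoning

  build : ℕ → List ℕ → List ℕ → List ℕ
  build i α β = map suc α ++ 0 ∷ map (suc i +_) β

  downFrom-suc : ∀ j → downFrom (suc j) ≡ map suc (downFrom j) ++ [ 1 ]
  downFrom-suc zero    = refl
  downFrom-suc (suc j) = cong (suc (suc j) ∷_) (downFrom-suc j)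

  hat-suc : ∀ j → hat (3 + j) ≡ map suc (hat (2 + j)) ++ [ 1 ]
  hat-suc j = cong (λ d → suc (suc j) ∷ suc (suc (suc j)) ∷ d) (downFrom-suc j)

  hat-positive : ∀ j → All (0 <_) (hat (2 + j))
  hat-positive j = s≤s z≤n ∷ s≤s z≤n ∷ downFrom-positive j
    where
    downFrom-positive : ∀ j → All (0 <_) (downFrom j)
    downFrom-positive zero    = []
    downFrom-positive (suc j) = s≤s z≤n ∷ downFrom-positive j

  not-∨ : ∀ a b → not (a ∨ b) ≡ not a ∧ not b
  not-∨ true  b = refl
  not-∨ false b = refl

  module Build (i : ℕ) {α : List ℕ} (β : List ℕ) (α<i : All (_< i) α) where

    private
      A B : List ℕ
      A = map suc α
      B = map (suc i +_) β

      A<B : All (λ a → All (a <_) B) A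
      A<B = AllP.map⁺ (All.map (λ a<i → AllP.map⁺ (All.universal (λ b → s≤s (≤-trans a<i (m≤m+n i b))) β)) α<i)

      0<all : ∀ {f : ℕ → ℕ} → (∀ x → 0 < f x) → ∀ xs → All (0 <_) (map f xs)
      0<all 0<f xs = AllP.map⁺ (All.universal 0<f xs)

    open MinimumBetween A B 0 (0<all (λ _ → s≤s z≤n) α) (0<all (λ _ → s≤s z≤n) β) A<B

    avoids-split : ∀ τ τ₁ τ₂ → contains τ (build i α β) ≡ contains τ₁ A ∨ contains τ₂ B →
      avoids τ (build i α β) ≡ avoids τ₁ α ∧ avoids τ₂ β
    avoids-split τ τ₁ τ₂ split = begin
      avoids τ (build i α β)                            ≡⟨ avoids≡not-contains τ (build i α β) ⟩
      not (contains τ (build i α β))                    ≡⟨ cong not split ⟩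
      not (contains τ₁ A ∨ contains τ₂ B)               ≡⟨ cong₂ (λ u v → not (u ∨ v))
                                                            (contains-map suc-orderPreserving τ₁ α)
                                                            (contains-map (+-orderPreserving (suc i)) τ₂ β) ⟩
      not (contains τ₁ α ∨ contains τ₂ β)               ≡⟨ not-∨ (contains τ₁ α) (contains τ₂ β) ⟩
      not (contains τ₁ α) ∧ not (contains τ₂ β)         ≡⟨ cong₂ _∧_ (avoids≡not-contains τ₁ α)
                                                                      (avoids≡not-contains τ₂ β) ⟨
      avoids τ₁ α ∧ avoids τ₂ β                         ∎

    avoids-312 : avoids p312 (build i α β) ≡ avoids p312 α ∧ avoids p312 β
    avoids-312 = avoids-split p312 p312 p312 contains-312

    avoids-hat : ∀ j → avoids (hat (3 + j)) (build i α β) ≡ avoids (hat (2 + j)) α ∧ avoids (hat (3 + j)) β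
    avoids-hat j = avoids-split (hat (3 + j)) (hat (2 + j)) (hat (3 + j))
      (≡.subst (λ τ → contains τ (build i α β) ≡ contains (hat (2 + j)) A ∨ contains τ B) (sym (hat-suc j))
        (contains-suc-∷ʳ-1 (suc j) _ (hat-positive j)))

    avoids-12 : avoids (hat 2) (build i α β) ≡ avoids (hat 2) α ∧ null β
    avoids-12 = begin
      avoids (hat 2) (build i α β)                 ≡⟨ avoids≡not-contains (hat 2) (build i α β) ⟩
      not (contains (hat 2) (build i α β))         ≡⟨ cong not contains-12 ⟩
      not (contains (hat 2) A ∨ not (null B))      ≡⟨ cong (λ u → not (u ∨ not (null B)))
                                                           (contains-map suc-orderPreserving (hat 2) α) ⟩
      not (contains (hat 2) α ∨ not (null B))      ≡⟨ not-∨ (contains (hat 2) α) (not (null B)) ⟩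
      not (contains (hat 2) α) ∧ not (not (null B)) ≡⟨ cong₂ _∧_ (sym (avoids≡not-contains (hat 2) α))
                                                                 (not-involutive (null B)) ⟩
      avoids (hat 2) α ∧ null B                    ≡⟨ cong (avoids (hat 2) α ∧_) (null-map β) ⟩
      avoids (hat 2) α ∧ null β                    ∎
      where
      null-map : ∀ xs → null (map (suc i +_) xs) ≡ null xs
      null-map []      = refl
      null-map (_ ∷ _) = refl

    lis-build : lis (build i α β) ≡ (lis α ⊔ 1) + lis β
    lis-build = trans lis-split
      (cong₂ (λ u v → (u ⊔ 1) + v) (lis-map suc-orderPreserving α) (lis-map (+-orderPreserving (suc i)) β))

module Permutations where

  open PatternContainment
  open import Data.Bool.Base using (true; false; T; if_then_else_)
  open import Data.Bool.Properties using (T-∧)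
  open import Data.Empty using (⊥-elim)
  open import Data.List.Base using (List; []; _∷_; _++_; map; length; filter; concatMap; upTo)
  open import Data.List.Properties using (length-++; ∷-injective)
  open import Data.List.Membership.Propositional using (_∈_; _∉_; find; lose)
  import Data.List.Membership.Propositional.Properties as ∈
  open import Data.List.Relation.Unary.All as All using (All; []; _∷_)
  import Data.List.Relation.Unary.All.Properties as AllP
  open import Data.List.Relation.Unary.Any as Any using (here; there)
  open import Data.List.Relation.Unary.AllPairs using ([]; _∷_)
  import Data.List.Relation.Unary.AllPairs.Properties as AllPairs
  open import Data.List.Relation.Unary.Unique.Propositional using (Unique)
  import Data.List.Relation.Unary.Unique.Propositional.Properties as Unique
  open import Data.Nat.Base using (ℕ; zero; suc; _+_; _∸_; _≤_; _<_; _≡ᵇ_; z≤n; s≤s)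
  open import Data.Nat.Properties as ℕ
    using (≡ᵇ⇒≡; ≡⇒≡ᵇ; suc-injective; ≤-trans; ≤-pred; ≤∧≢⇒<; n≤1+n; ∸-monoˡ-≤;
           +-∸-assoc; +-suc)
  open import Data.Product.Base using (_×_; _,_; proj₁; proj₂)
  open import Data.Sum.Base using (inj₁; inj₂)
  open import Data.Unit.Base using (tt)
  open import Function.Base using (_∘_)
  open import Function.Bundles using (Equivalence)
  open import Relation.Nullary.Decidable using (yes; no; T?)
  open import Relation.Nullary.Negation using (¬_)
  open import Relation.Binary.PropositionalEquality using (_≡_; _≢_; refl; sym; cong; subst)

  Unique-++⁻ : ∀ xs {ys} → Unique (xs ++ ys) → Unique xs × Unique ys × All (λ x → All (x ≢_) ys) xs
  Unique-++⁻ xs = AllPairs-++⁻ {xs = xs}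

  Unique-remove : ∀ xs {v zs} → Unique (xs ++ v ∷ zs) → Unique (xs ++ zs) × v ∉ xs ++ zs
  Unique-remove xs {v} {zs} u with Unique-++⁻ xs u
  ... | u-xs , v∉zs ∷ u-zs , xs≢vzs =
    AllPairs.++⁺ u-xs u-zs (All.map All.tail xs≢vzs) , v∉
    where
    v∉ : v ∉ xs ++ zs
    v∉ v∈ with ∈.∈-++⁻ xs v∈
    ... | inj₁ v∈xs = All.head (All.lookup xs≢vzs v∈xs) refl
    ... | inj₂ v∈zs = All.lookup v∉zs v∈zs refl

  InRange : ℕ → ℕ → ℕ → Set
  InRange lo hi x = lo ≤ x × x < hi

  InRange-shrink : ∀ {lo hi} xs → All (InRange lo (suc hi)) xs → hi ∉ xs → All (InRange lo hi) xs
  InRange-shrink []       _                  _   = []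
  InRange-shrink (x ∷ xs) ((lo≤x , x<) ∷ rs) hi∉ =
    (lo≤x , ≤∧≢⇒< (≤-pred x<) (λ x≡hi → hi∉ (here (sym x≡hi)))) ∷ InRange-shrink xs rs (hi∉ ∘ there)

  Unique-length≤ : ∀ hi lo xs → Unique xs → All (InRange lo hi) xs → length xs ≤ hi ∸ lo
  Unique-length≤ zero     lo []       _ _            = z≤n
  Unique-length≤ zero     lo (x ∷ xs) _ ((_ , ()) ∷ _)
  Unique-length≤ (suc hi) lo xs u in-range with Any.any? (hi ℕ.≟_) xs
  ... | no hi∉ = ≤-trans (Unique-length≤ hi lo xs u (InRange-shrink xs in-range hi∉)) (∸-monoˡ-≤ lo (n≤1+n hi))
  ... | yes hi∈ with ∈.∈-∃++ hi∈
  ...   | ys , zs , refl with Unique-remove ys u | AllP.++⁻ ys in-range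
  ...     | u′ , hi∉ | in-ys , (lo≤hi , _) ∷ in-zs = begin
    length (ys ++ hi ∷ zs)       ≡⟨ length-++ ys ⟩
    length ys + suc (length zs)  ≡⟨ +-suc _ _ ⟩
    suc (length ys + length zs)  ≡⟨ cong suc (length-++ ys) ⟨
    suc (length (ys ++ zs))      ≤⟨ s≤s (Unique-length≤ hi lo (ys ++ zs) u′
                                      (InRange-shrink (ys ++ zs) (AllP.++⁺ in-ys in-zs) hi∉)) ⟩
    suc (hi ∸ lo)                ≡⟨ +-∸-assoc 1 lo≤hi ⟨
    suc hi ∸ lo                  ∎
    where open ℕ.≤-Reasoning

  differs⁻ : ∀ a b → T (if a ≡ᵇ b then false else true) → a ≢ b
  differs⁻ a b t a≡b with a ≡ᵇ b | ≡⇒≡ᵇ a b a≡b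
  differs⁻ a b () a≡b | true  | _
  differs⁻ a b t  a≡b | false | ()

  differs⁺ : ∀ a b → a ≢ b → T (if a ≡ᵇ b then false else true)
  differs⁺ a b a≢b with a ≡ᵇ b in eq
  ... | true  = ⊥-elim (a≢b (≡ᵇ⇒≡ a b (subst T (sym eq) tt)))
  ... | false = tt

  distinct⁻ : ∀ xs → T (distinct xs) → Unique xs
  distinct⁻ []       _ = []
  distinct⁻ (x ∷ xs) t with Equivalence.to T-∧ t
  ... | x∉xs , d = All.map (differs⁻ x _) (AllP.all⁺ _ xs x∉xs) ∷ distinct⁻ xs d

  distinct⁺ : ∀ xs → Unique xs → T (distinct xs)
  distinct⁺ []       _            = tt
  distinct⁺ (x ∷ xs) (x∉xs ∷ u) =
    Equivalence.from T-∧ (AllP.all⁻ _ (All.map (differs⁺ x _) x∉xs) , distinct⁺ xs u)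

  words⁻ : ∀ n len σ → σ ∈ words n len → length σ ≡ len × All (_< n) σ
  words⁻ n zero      σ (here refl) = refl , []
  words⁻ n (suc len) σ σ∈ with find (∈.∈-concatMap⁻ (λ a → map (a ∷_) (words n len)) {xs = upTo n} σ∈)
  ... | a , a∈ , σ∈a with ∈.∈-map⁻ (a ∷_) σ∈a
  ...   | σ′ , σ′∈ , refl with words⁻ n len σ′ σ′∈
  ...     | len≡ , σ′<n = cong suc len≡ , ∈.∈-upTo⁻ a∈ ∷ σ′<n

  words⁺ : ∀ n len σ → length σ ≡ len → All (_< n) σ → σ ∈ words n len
  words⁺ n zero      []      refl []           = here refl
  words⁺ n (suc len) (a ∷ σ) len≡ (a<n ∷ σ<n) =
    ∈.∈-concatMap⁺ (λ a → map (a ∷_) (words n len))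
      (lose (∈.∈-upTo⁺ a<n) (∈.∈-map⁺ (a ∷_) (words⁺ n len σ (suc-injective len≡) σ<n)))

  Unique-concatMap : ∀ {A : Set} (f : ℕ → List A) is → Unique is → (∀ i → Unique (f i)) →
    (∀ {i j x} → x ∈ f i → x ∈ f j → i ≡ j) → Unique (concatMap f is)
  Unique-concatMap f []       _            _        _      = []
  Unique-concatMap f (i ∷ is) (i∉is ∷ u) unique-f tagged =
    Unique.++⁺ (unique-f i) (Unique-concatMap f is u unique-f tagged) disjoint
    where
    disjoint : ∀ {v} → ¬ (v ∈ f i × v ∈ concatMap f is)
    disjoint (v∈fi , v∈rest) with find (∈.∈-concatMap⁻ f {xs = is} v∈rest)
    ... | j , j∈is , v∈fj = All.lookup i∉is j∈is (tagged v∈fi v∈fj)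

  words-unique : ∀ n len → Unique (words n len)
  words-unique n zero      = [] ∷ []
  words-unique n (suc len) = Unique-concatMap (λ a → map (a ∷_) (words n len)) (upTo n) (Unique.upTo⁺ n)
    (λ a → Unique.map⁺ (λ eq → proj₂ (∷-injective eq)) (words-unique n len)) same-head
    where
    same-head : ∀ {i j x} → x ∈ map (i ∷_) (words n len) → x ∈ map (j ∷_) (words n len) → i ≡ j
    same-head x∈ x∈′ with ∈.∈-map⁻ _ x∈ | ∈.∈-map⁻ _ x∈′
    ... | _ , _ , refl | _ , _ , eq = proj₁ (∷-injective eq)

  IsPerm : ℕ → List ℕ → Set
  IsPerm n σ = length σ ≡ n × All (_< n) σ × Unique σ

  perms⁻ : ∀ {n σ} → σ ∈ perms n → IsPerm n σ
  perms⁻ {n} {σ} σ∈ with ∈.∈-filter⁻ (λ w → T? (distinct w)) σ∈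
  ... | σ∈words , d with words⁻ n n σ σ∈words
  ...   | len≡ , σ<n = len≡ , σ<n , distinct⁻ σ d

  perms⁺ : ∀ {n σ} → IsPerm n σ → σ ∈ perms n
  perms⁺ {n} {σ} (len≡ , σ<n , u) =
    ∈.∈-filter⁺ (λ w → T? (distinct w)) (words⁺ n n σ len≡ σ<n) (distinct⁺ σ u)

  S : ℕ → List (List ℕ)
  S n = filter (λ σ → T? (avoids p312 σ)) (perms n)

  S⁻ : ∀ {n σ} → σ ∈ S n → IsPerm n σ × T (avoids p312 σ)
  S⁻ σ∈ with ∈.∈-filter⁻ (λ σ → T? (avoids p312 σ)) σ∈
  ... | σ∈perms , av = perms⁻ σ∈perms , av

  S⁺ : ∀ {n σ} → IsPerm n σ → T (avoids p312 σ) → σ ∈ S n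
  S⁺ p av = ∈.∈-filter⁺ (λ σ → T? (avoids p312 σ)) (perms⁺ p) av

  S-unique : ∀ n → Unique (S n)
  S-unique n = Unique.filter⁺ (λ σ → T? (avoids p312 σ)) (Unique.filter⁺ (λ w → T? (distinct w)) (words-unique n n))

module Enumeration where

  open PatternContainment
  open Building
  open Permutations
  open import Data.Bool.Base using (T; _∧_)
  open import Data.Bool.Properties using (T-∧)
  open import Data.Empty using (⊥; ⊥-elim)
  open import Data.List.Base using (List; []; _∷_; _++_; map; length; concatMap; upTo; cartesianProductWith)
  open import Data.List.Properties using (length-++; length-map; map-injective)
  open import Data.List.Membership.Propositional using (_∈_; _∉_; find; lose)
  import Data.List.Membership.Propositional.Properties as ∈
  open import Data.List.Membership.Propositional.Properties.WithK using (unique∧set⇒bag)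
  open import Data.List.Relation.Binary.BagAndSetEquality using (∼bag⇒↭)
  open import Data.List.Relation.Binary.Permutation.Propositional using (_↭_)
  open import Data.List.Relation.Binary.Sublist.Propositional using (_⊆_; _∷_; from∈)
  open import Data.List.Relation.Binary.Sublist.Propositional.Properties using (++⁺)
  open import Data.List.Relation.Unary.All as All using (All; []; _∷_)
  import Data.List.Relation.Unary.All.Properties as AllP
  open import Data.List.Relation.Unary.Any as Any using (here; there)
  open import Data.List.Relation.Unary.AllPairs using ([]; _∷_)
  open import Data.List.Relation.Unary.Unique.Propositional using (Unique)
  import Data.List.Relation.Unary.Unique.Propositional.Properties as Unique
  open import Data.Nat.Base using (ℕ; zero; suc; _+_; _∸_; _≤_; _<_; z≤n; s≤s; pred)
  open import Function.Base using (_∘_)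
  open import Data.Nat.Properties as ℕ
    using (suc-injective; ≤-trans; ≤-<-trans; <-≤-trans; ≤-pred; <-irrefl; +-suc; +-monoʳ-≤;
           m+[n∸m]≡n; m+n∸m≡n; m≤m+n; +-cancelˡ-≡; <-cmp; ∸-monoʳ-<; ∸-monoˡ-<; ≰⇒>; ≮⇒≥)
  open import Data.Product.Base using (∃; ∃₂; _×_; _,_; proj₁; proj₂)
  open import Data.Unit.Base using (tt)
  open import Function.Bundles using (mk⇔; Equivalence)
  open import Relation.Binary.Definitions using (tri<; tri≈; tri>)
  open import Relation.Nullary.Decidable using (yes; no)
  open import Relation.Nullary.Negation using (¬_)
  open import Relation.Binary.PropositionalEquality as ≡ using (_≡_; _≢_; refl; sym; trans; cong; cong₂; subst)

  build∈S : ∀ {n i α β} → i ≤ n → α ∈ S i → β ∈ S (n ∸ i) → build i α β ∈ S (suc n)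
  build∈S {n} {i} {α} {β} i≤n α∈ β∈ with S⁻ α∈ | S⁻ β∈
  ... | (len-α , α<i , u-α) , av-α | (len-β , β<n-i , u-β) , av-β = S⁺ (len , bounded , unique) avoids312
    where
    len : length (build i α β) ≡ suc n
    len = begin
      length (build i α β)                                   ≡⟨ length-++ (map suc α) ⟩
      length (map suc α) + suc (length (map (suc i +_) β))   ≡⟨ cong₂ (λ u v → u + suc v)
                                                                  (length-map suc α) (length-map (suc i +_) β) ⟩
      length α + suc (length β)                              ≡⟨ cong₂ (λ u v → u + suc v) len-α len-β ⟩
      i + suc (n ∸ i)                                        ≡⟨ +-suc i (n ∸ i) ⟩
      suc (i + (n ∸ i))                                      ≡⟨ cong suc (m+[n∸m]≡n i≤n) ⟩
      suc n                                                  ∎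
      where open ≡.≡-Reasoning
    shift< : ∀ {b} → b < n ∸ i → suc i + b < suc n
    shift< {b} b< = s≤s (subst (_≤ n) (+-suc i b) (subst (i + suc b ≤_) (m+[n∸m]≡n i≤n) (+-monoʳ-≤ i b<)))
    bounded : All (_< suc n) (build i α β)
    bounded = AllP.++⁺ (AllP.map⁺ (All.map (λ a<i → s≤s (≤-trans a<i i≤n)) α<i))
                       (s≤s z≤n ∷ AllP.map⁺ (All.map shift< β<n-i))
    unique : Unique (build i α β)
    unique = Unique.++⁺ (Unique.map⁺ suc-injective u-α)
      (AllP.map⁺ (All.universal (λ _ ()) β) ∷ Unique.map⁺ (+-cancelˡ-≡ (suc i) _ _) u-β)
      disjoint
      where
      disjoint : ∀ {v} → ¬ (v ∈ map suc α × v ∈ 0 ∷ map (suc i +_) β)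
      disjoint (v∈α , here refl) with ∈.∈-map⁻ suc v∈α
      ... | _ , _ , ()
      disjoint (v∈α , there v∈β) with ∈.∈-map⁻ suc v∈α | ∈.∈-map⁻ (suc i +_) v∈β
      ... | a , a∈ , refl | b , _ , eq =
        <-irrefl (suc-injective eq) (<-≤-trans (All.lookup α<i a∈) (m≤m+n i b))
    avoids312 : T (avoids p312 (build i α β))
    avoids312 = subst T (sym (Build.avoids-312 i β α<i)) (Equivalence.from T-∧ (av-α , av-β))

  map-pred-suc : ∀ xs → All (0 <_) xs → map suc (map pred xs) ≡ xs
  map-pred-suc []           []      = refl
  map-pred-suc (suc x ∷ xs) (_ ∷ p) = cong (suc x ∷_) (map-pred-suc xs p)

  map-+-∸ : ∀ c xs → All (c ≤_) xs → map (c +_) (map (_∸ c) xs) ≡ xs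
  map-+-∸ c []       []           = refl
  map-+-∸ c (x ∷ xs) (c≤x ∷ c≤xs) = cong₂ _∷_ (m+[n∸m]≡n c≤x) (map-+-∸ c xs c≤xs)

  -- 312-avoidance forces prefix < suffix around the entry 0, so prefix is a
  -- permutation of 1 … i and suffix one of i + 1 … n.
  module Decomposition {n σ} (σ∈ : σ ∈ S (suc n)) where

    private
      len-σ : length σ ≡ suc n
      len-σ = proj₁ (proj₁ (S⁻ {suc n} σ∈))
      σ<n : All (_< suc n) σ
      σ<n = proj₁ (proj₂ (proj₁ (S⁻ {suc n} σ∈)))
      u-σ : Unique σ
      u-σ = proj₂ (proj₂ (proj₁ (S⁻ {suc n} σ∈)))
      no312 : ¬ Contains p312 σ
      no312 = avoids⇒¬Contains p312 σ (proj₂ (S⁻ {suc n} σ∈))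

    0∈σ : 0 ∈ σ
    0∈σ with Any.any? (0 ℕ.≟_) σ
    ... | yes 0∈ = 0∈
    ... | no  0∉ = ⊥-elim (<-irrefl refl (≤-trans (ℕ.≤-reflexive (sym len-σ))
      (Unique-length≤ (suc n) 1 σ u-σ (All.tabulate (λ {x} x∈ →
        ℕ.n≢0⇒n>0 (λ x≡0 → 0∉ (subst (_∈ σ) x≡0 x∈)) , All.lookup σ<n x∈)))))

    prefix suffix : List ℕ
    prefix = proj₁ (∈.∈-∃++ 0∈σ)
    suffix = proj₁ (proj₂ (∈.∈-∃++ 0∈σ))

    σ≡ : σ ≡ prefix ++ 0 ∷ suffix
    σ≡ = proj₂ (proj₂ (∈.∈-∃++ 0∈σ))

    i : ℕ
    i = length prefix

    private
      u-ps : Unique (prefix ++ suffix)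
      u-ps = proj₁ (Unique-remove prefix (subst Unique σ≡ u-σ))
      0∉ : 0 ∉ prefix ++ suffix
      0∉ = proj₂ (Unique-remove prefix (subst Unique σ≡ u-σ))
      u-p : Unique prefix
      u-p = proj₁ (Unique-++⁻ prefix u-ps)
      u-s : Unique suffix
      u-s = proj₁ (proj₂ (Unique-++⁻ prefix u-ps))
      p<n : All (_< suc n) prefix
      p<n = AllP.++⁻ˡ prefix (subst (All (_< suc n)) σ≡ σ<n)
      s<n : All (_< suc n) suffix
      s<n = All.tail (AllP.++⁻ʳ prefix (subst (All (_< suc n)) σ≡ σ<n))

      length-split : i + length suffix ≡ n
      length-split = suc-injective (begin
        suc (i + length suffix)        ≡⟨ +-suc i (length suffix) ⟨
        i + suc (length suffix)        ≡⟨ length-++ prefix ⟨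
        length (prefix ++ 0 ∷ suffix)  ≡⟨ cong length σ≡ ⟨
        length σ                       ≡⟨ len-σ ⟩
        suc n                          ∎)
        where open ≡.≡-Reasoning

    length-suffix : length suffix ≡ n ∸ i
    length-suffix = trans (sym (m+n∸m≡n i (length suffix))) (cong (_∸ i) length-split)

    i≤n : i ≤ n
    i≤n = subst (i ≤_) length-split (m≤m+n i (length suffix))

    prefix-positive : All (0 <_) prefix
    prefix-positive = All.tabulate (λ {x} x∈ →
      ℕ.n≢0⇒n>0 (λ x≡0 → 0∉ (∈.∈-++⁺ˡ (subst (_∈ prefix) x≡0 x∈))))

    suffix-positive : All (0 <_) suffix
    suffix-positive = All.tabulate (λ {x} x∈ →
      ℕ.n≢0⇒n>0 (λ x≡0 → 0∉ (∈.∈-++⁺ʳ prefix (subst (_∈ suffix) x≡0 x∈))))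

    prefix<suffix : ∀ {a b} → a ∈ prefix → b ∈ suffix → a < b
    prefix<suffix {a} {b} a∈ b∈ with <-cmp a b
    ... | tri< a<b _ _ = a<b
    ... | tri≈ _ a≡b _ = ⊥-elim (All.lookup (All.lookup (proj₂ (proj₂ (Unique-++⁻ prefix u-ps))) a∈) b∈ a≡b)
    ... | tri> _ _ b<a = ⊥-elim (no312 (a ∷ 0 ∷ b ∷ [] ,
          subst (_ ⊆_) (sym σ≡) (++⁺ (from∈ a∈) (refl ∷ from∈ b∈)) ,
          ((refl , sym (<ᵇ-true 0<a)) , (sym (<ᵇ-false b<a) , sym (<ᵇ-true b<a)) , tt) ,
          ((sym (<ᵇ-true 0<b) , refl) , tt) , (tt , tt)))
      where
      0<a = All.lookup prefix-positive a∈
      0<b = All.lookup suffix-positive b∈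

    prefix≤i : All (_≤ i) prefix
    prefix≤i = All.tabulate bound
      where
      bound : ∀ {a} → a ∈ prefix → a ≤ i
      bound {a} a∈ with a ℕ.≤? i
      ... | yes a≤i = a≤i
      ... | no  a≰i = ⊥-elim (<-irrefl refl (≤-<-trans suffix-above-a
        (subst (n ∸ a <_) (sym length-suffix) (∸-monoʳ-< (≰⇒> a≰i) (≤-pred (All.lookup p<n a∈))))))
        where
        suffix-above-a : length suffix ≤ suc n ∸ suc a
        suffix-above-a = Unique-length≤ (suc n) (suc a) suffix u-s
          (All.tabulate (λ b∈ → prefix<suffix a∈ b∈ , All.lookup s<n b∈))

    i<suffix : All (i <_) suffix
    i<suffix = All.tabulate bound
      where
      bound : ∀ {b} → b ∈ suffix → i < b
      bound {b} b∈ with i ℕ.<? b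
      ... | yes i<b = i<b
      ... | no  i≮b = ⊥-elim (below b (All.lookup suffix-positive b∈) prefix-below-b (≮⇒≥ i≮b))
        where
        prefix-below-b : i ≤ b ∸ 1
        prefix-below-b = Unique-length≤ b 1 prefix u-p
          (All.tabulate (λ a∈ → All.lookup prefix-positive a∈ , prefix<suffix a∈ b∈))
        below : ∀ b → 0 < b → i ≤ b ∸ 1 → b ≤ i → ⊥
        below (suc b′) _ i≤b′ b≤i = <-irrefl refl (≤-trans (s≤s i≤b′) b≤i)

    α β : List ℕ
    α = map pred prefix
    β = map (_∸ suc i) suffix

    σ≡build : σ ≡ build i α β
    σ≡build = trans σ≡ (sym (cong₂ (λ u v → u ++ 0 ∷ v)
      (map-pred-suc prefix prefix-positive) (map-+-∸ (suc i) suffix i<suffix)))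

    private
      α<i : All (_< i) α
      α<i = AllP.map⁺ (All.zipWith (λ { {suc a} (_ , a<) → a< }) (prefix-positive , prefix≤i))

      β<n-i : All (_< n ∸ i) β
      β<n-i = AllP.map⁺ (All.zipWith (λ (i<b , b<) → ∸-monoˡ-< b< i<b) (i<suffix , s<n))

      u-α : Unique α
      u-α = Unique.map⁻ (subst Unique (sym (map-pred-suc prefix prefix-positive)) u-p)

      u-β : Unique β
      u-β = Unique.map⁻ (subst Unique (sym (map-+-∸ (suc i) suffix i<suffix)) u-s)

      av-αβ : T (avoids p312 α ∧ avoids p312 β)
      av-αβ = subst T (Build.avoids-312 i β α<i) (subst (T ∘ avoids p312) σ≡build (proj₂ (S⁻ {suc n} σ∈)))

    α∈ : α ∈ S i
    α∈ = S⁺ (length-map pred prefix , α<i , u-α) (proj₁ (Equivalence.to T-∧ av-αβ))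

    β∈ : β ∈ S (n ∸ i)
    β∈ = S⁺ (trans (length-map (_∸ suc i) suffix) length-suffix , β<n-i , u-β) (proj₂ (Equivalence.to T-∧ av-αβ))

  decompose : ∀ {n σ} → σ ∈ S (suc n) →
    ∃ λ i → i ≤ n × ∃₂ λ α β → α ∈ S i × β ∈ S (n ∸ i) × σ ≡ build i α β
  decompose {n} σ∈ = i , i≤n , α , β , α∈ , β∈ , σ≡build
    where open Decomposition {n} σ∈

  beforeZero afterZero : List ℕ → List ℕ
  beforeZero []           = []
  beforeZero (zero  ∷ xs) = []
  beforeZero (suc x ∷ xs) = suc x ∷ beforeZero xs
  afterZero  []           = []
  afterZero  (zero  ∷ xs) = xs
  afterZero  (suc x ∷ xs) = afterZero xs

  beforeZero-build : ∀ α ys → beforeZero (map suc α ++ 0 ∷ ys) ≡ map suc α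
  beforeZero-build []      ys = refl
  beforeZero-build (a ∷ α) ys = cong (suc a ∷_) (beforeZero-build α ys)

  afterZero-build : ∀ α ys → afterZero (map suc α ++ 0 ∷ ys) ≡ ys
  afterZero-build []      ys = refl
  afterZero-build (a ∷ α) ys = afterZero-build α ys

  build-injective : ∀ {i j α α′ β β′} → build i α β ≡ build j α′ β′ →
    map suc α ≡ map suc α′ × map (suc i +_) β ≡ map (suc j +_) β′
  build-injective {α = α} {α′} eq =
    trans (sym (beforeZero-build α _)) (trans (cong beforeZero eq) (beforeZero-build α′ _)) ,
    trans (sym (afterZero-build α _)) (trans (cong afterZero eq) (afterZero-build α′ _))

  builds : ℕ → List (List ℕ)
  builds n = concatMap (λ i → cartesianProductWith (build i) (S i) (S (n ∸ i))) (upTo (suc n))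

  builds-unique : ∀ n → Unique (builds n)
  builds-unique n =
    Unique-concatMap (λ i → cartesianProductWith (build i) (S i) (S (n ∸ i))) (upTo (suc n)) (Unique.upTo⁺ (suc n))
    (λ i → Unique.cartesianProductWith⁺ (build i) build-injective′ (S-unique i) (S-unique (n ∸ i)))
    same-i
    where
    build-injective′ : ∀ {i α α′ β β′} → build i α β ≡ build i α′ β′ → α ≡ α′ × β ≡ β′
    build-injective′ {i} eq with build-injective eq
    ... | eq₁ , eq₂ = map-injective suc-injective eq₁ , map-injective (+-cancelˡ-≡ (suc i) _ _) eq₂
    same-i : ∀ {i j σ} → σ ∈ cartesianProductWith (build i) (S i) (S (n ∸ i)) →
                         σ ∈ cartesianProductWith (build j) (S j) (S (n ∸ j)) → i ≡ j
    same-i {i} {j} σ∈ σ∈′ with ∈.∈-cartesianProductWith⁻ (build i) (S i) _ σ∈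
                              | ∈.∈-cartesianProductWith⁻ (build j) (S j) _ σ∈′
    ... | α , β , α∈ , _ , refl | α′ , β′ , α′∈ , _ , eq = begin
      i                    ≡⟨ proj₁ (proj₁ (S⁻ {i} α∈)) ⟨
      length α             ≡⟨ length-map suc α ⟨
      length (map suc α)   ≡⟨ cong length (proj₁ (build-injective eq)) ⟩
      length (map suc α′)  ≡⟨ length-map suc α′ ⟩
      length α′            ≡⟨ proj₁ (proj₁ (S⁻ {j} α′∈)) ⟩
      j                    ∎
      where open ≡.≡-Reasoning

  S↭builds : ∀ n → S (suc n) ↭ builds n
  S↭builds n = ∼bag⇒↭ (unique∧set⇒bag (S-unique (suc n)) (builds-unique n) (mk⇔ S⊆builds builds⊆S))
    where
    S⊆builds : ∀ {σ} → σ ∈ S (suc n) → σ ∈ builds n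
    S⊆builds σ∈ with decompose σ∈
    ... | i , i≤n , α , β , α∈ , β∈ , refl =
      ∈.∈-concatMap⁺ (λ i → cartesianProductWith (build i) (S i) (S (n ∸ i)))
        (lose (∈.∈-upTo⁺ (s≤s i≤n)) (∈.∈-cartesianProductWith⁺ (build i) α∈ β∈))
    builds⊆S : ∀ {σ} → σ ∈ builds n → σ ∈ S (suc n)
    builds⊆S σ∈
      with find (∈.∈-concatMap⁻ (λ i → cartesianProductWith (build i) (S i) (S (n ∸ i))) {xs = upTo (suc n)} σ∈)
    ... | i , i∈ , σ∈i with ∈.∈-cartesianProductWith⁻ (build i) (S i) _ σ∈i
    ...   | α , β , α∈ , β∈ , refl = build∈S (≤-pred (∈.∈-upTo⁻ i∈)) α∈ β∈

module Counting where

  open PatternContainment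
  open Building
  open Permutations
  open Enumeration
  open import Data.Bool.Base using (Bool; true; false; T; _∧_)
  open import Data.List.Base using (List; []; _∷_; _++_; map; length; filter; concatMap; upTo; applyUpTo; cartesianProductWith)
  open import Data.List.Membership.Propositional using (_∈_)
  open import Data.List.Relation.Binary.Permutation.Propositional using (_↭_)
  open import Data.List.Relation.Binary.Permutation.Propositional.Properties using (↭-length; filter-↭)
  open import Data.List.Relation.Unary.All using (All)
  open import Data.List.Relation.Unary.Any using (here; there)
  open import Data.Nat.Base using (ℕ; zero; suc; _+_; _*_; _∸_; _≤_; _<_; _≡ᵇ_; _⊔_)
  open import Data.Nat.Properties as ℕ
    using (+-assoc; +-identityʳ; *-zeroʳ; *-distribʳ-+; *-distribˡ-+; ≡ᵇ⇒≡; ≡⇒≡ᵇ;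
           m+n∸m≡n; m+[n∸m]≡n; m≤m+n; <⇒≢; ≤-pred; n<1+n; <-trans; m≤n⇒m<n∨m≡n; ≤-refl; ≰⇒>)
  open import Data.Product.Base using (proj₁; proj₂)
  open import Data.Sum.Base using (inj₁; inj₂)
  open import Function.Base using (_∘_)
  open import Relation.Nullary.Decidable using (yes; no; T?)
  open import Relation.Binary.PropositionalEquality as ≡ using (_≡_; _≢_; refl; sym; trans; cong; cong₂; subst)
  open import Data.Empty using (⊥-elim)
  open import Data.Unit.Base using (tt)
  open import Function.Bundles using (mk⇔)
  open ≡.≡-Reasoning
  open import Algebra.Properties.CommutativeSemigroup ℕ.+-commutativeSemigroup using (interchange)

  indicator : Bool → ℕ
  indicator true  = 1
  indicator false = 0

  sumOver : ∀ {A : Set} → (A → ℕ) → List A → ℕ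
  sumOver f []       = 0
  sumOver f (x ∷ xs) = f x + sumOver f xs

  sumUpTo : ℕ → (ℕ → ℕ) → ℕ
  sumUpTo zero    f = f 0
  sumUpTo (suc n) f = sumUpTo n f + f (suc n)

  count : (List ℕ → Bool) → List (List ℕ) → ℕ
  count p xs = length (filter (λ x → T? (p x)) xs)

  count≡sumOver : ∀ p xs → count p xs ≡ sumOver (indicator ∘ p) xs
  count≡sumOver p []       = refl
  count≡sumOver p (x ∷ xs) with p x
  ... | true  = cong suc (count≡sumOver p xs)
  ... | false = count≡sumOver p xs

  count-↭ : ∀ p {xs ys} → xs ↭ ys → count p xs ≡ count p ys
  count-↭ p xs↭ys = ↭-length (filter-↭ (λ x → T? (p x)) xs↭ys)

  count-filter : ∀ (p r : List ℕ → Bool) xs →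
    length (filter (λ x → T? (p x ∧ r x)) xs) ≡ count r (filter (λ x → T? (p x)) xs)
  count-filter p r []       = refl
  count-filter p r (x ∷ xs) with p x
  ... | false = count-filter p r xs
  ... | true with r x
  ...   | true  = cong suc (count-filter p r xs)
  ...   | false = count-filter p r xs

  sumOver-cong∈ : ∀ {A : Set} {f g : A → ℕ} xs → (∀ x → x ∈ xs → f x ≡ g x) → sumOver f xs ≡ sumOver g xs
  sumOver-cong∈ []       f≡g = refl
  sumOver-cong∈ (x ∷ xs) f≡g = cong₂ _+_ (f≡g x (here refl)) (sumOver-cong∈ xs (λ y y∈ → f≡g y (there y∈)))

  sumOver-++ : ∀ {A : Set} (f : A → ℕ) xs ys → sumOver f (xs ++ ys) ≡ sumOver f xs + sumOver f ys
  sumOver-++ f []       ys = refl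
  sumOver-++ f (x ∷ xs) ys = trans (cong (f x +_) (sumOver-++ f xs ys)) (sym (+-assoc (f x) _ _))

  sumOver-concatMap : ∀ {A B : Set} (f : B → ℕ) (g : A → List B) xs →
    sumOver f (concatMap g xs) ≡ sumOver (sumOver f ∘ g) xs
  sumOver-concatMap f g []       = refl
  sumOver-concatMap f g (x ∷ xs) = trans (sumOver-++ f (g x) _) (cong (sumOver f (g x) +_) (sumOver-concatMap f g xs))

  sumOver-map : ∀ {A B : Set} (f : B → ℕ) (h : A → B) xs → sumOver f (map h xs) ≡ sumOver (f ∘ h) xs
  sumOver-map f h []       = refl
  sumOver-map f h (x ∷ xs) = cong (f (h x) +_) (sumOver-map f h xs)

  sumOver-cartesianProductWith : ∀ {A B C : Set} (f : C → ℕ) (h : A → B → C) xs ys →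
    sumOver f (cartesianProductWith h xs ys) ≡ sumOver (λ x → sumOver (f ∘ h x) ys) xs
  sumOver-cartesianProductWith f h []       ys = refl
  sumOver-cartesianProductWith f h (x ∷ xs) ys =
    trans (sumOver-++ f (map (h x) ys) _) (cong₂ _+_ (sumOver-map f (h x) ys) (sumOver-cartesianProductWith f h xs ys))

  sumOver-*ˡ : ∀ {A : Set} (f : A → ℕ) c xs → sumOver (λ x → c * f x) xs ≡ c * sumOver f xs
  sumOver-*ˡ f c []       = sym (*-zeroʳ c)
  sumOver-*ˡ f c (x ∷ xs) = trans (cong (c * f x +_) (sumOver-*ˡ f c xs)) (sym (*-distribˡ-+ c (f x) _))

  sumOver-*ʳ : ∀ {A : Set} (f : A → ℕ) c xs → sumOver (λ x → f x * c) xs ≡ sumOver f xs * c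
  sumOver-*ʳ f c []       = refl
  sumOver-*ʳ f c (x ∷ xs) = trans (cong (f x * c +_) (sumOver-*ʳ f c xs)) (sym (*-distribʳ-+ c (f x) _))

  sumUpTo-cong : ∀ n {f g} → (∀ i → f i ≡ g i) → sumUpTo n f ≡ sumUpTo n g
  sumUpTo-cong zero    f≡g = f≡g 0
  sumUpTo-cong (suc n) f≡g = cong₂ _+_ (sumUpTo-cong n f≡g) (f≡g (suc n))

  sumUpTo-zero : ∀ n → sumUpTo n (λ _ → 0) ≡ 0
  sumUpTo-zero zero    = refl
  sumUpTo-zero (suc n) = trans (+-identityʳ _) (sumUpTo-zero n)

  sumUpTo-distrib-+ : ∀ n f g → sumUpTo n (λ i → f i + g i) ≡ sumUpTo n f + sumUpTo n g
  sumUpTo-distrib-+ zero    f g = refl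
  sumUpTo-distrib-+ (suc n) f g = trans (cong (_+ (f (suc n) + g (suc n))) (sumUpTo-distrib-+ n f g))
    (interchange (sumUpTo n f) (sumUpTo n g) (f (suc n)) (g (suc n)))

  sumOver-sumUpTo-comm : ∀ {A : Set} (F : A → ℕ → ℕ) xs n →
    sumOver (λ x → sumUpTo n (F x)) xs ≡ sumUpTo n (λ a → sumOver (λ x → F x a) xs)
  sumOver-sumUpTo-comm F []       n = sym (sumUpTo-zero n)
  sumOver-sumUpTo-comm F (x ∷ xs) n =
    trans (cong (sumUpTo n (F x) +_) (sumOver-sumUpTo-comm F xs n)) (sym (sumUpTo-distrib-+ n (F x) _))

  sumOver-upTo : ∀ (f : ℕ → ℕ) n → sumOver f (upTo (suc n)) ≡ sumUpTo n f
  sumOver-upTo f n = applyUpTo-sum f (λ x → x) n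
    where
    sumUpTo-head : ∀ n (h : ℕ → ℕ) → h 0 + sumUpTo n (h ∘ suc) ≡ sumUpTo (suc n) h
    sumUpTo-head zero    h = refl
    sumUpTo-head (suc n) h = trans (sym (+-assoc (h 0) _ _)) (cong (_+ h (suc (suc n))) (sumUpTo-head n h))
    applyUpTo-sum : ∀ (f g : ℕ → ℕ) n → sumOver f (applyUpTo g (suc n)) ≡ sumUpTo n (f ∘ g)
    applyUpTo-sum f g zero    = +-identityʳ _
    applyUpTo-sum f g (suc n) =
      trans (cong (f (g 0) +_) (applyUpTo-sum f (g ∘ suc) n)) (sumUpTo-head n (f ∘ g))

  ≡ᵇ-refl : ∀ m → (m ≡ᵇ m) ≡ true
  ≡ᵇ-refl zero    = refl
  ≡ᵇ-refl (suc m) = ≡ᵇ-refl m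

  ≡ᵇ-false : ∀ {m n} → m ≢ n → (m ≡ᵇ n) ≡ false
  ≡ᵇ-false {m} {n} m≢n with m ≡ᵇ n in eq
  ... | true  = ⊥-elim (m≢n (≡ᵇ⇒≡ m n (subst T (sym eq) tt)))
  ... | false = refl

  sumUpTo-delta-beyond : ∀ k c (v : ℕ → ℕ) → k < c → sumUpTo k (λ a → indicator (c ≡ᵇ a) * v a) ≡ 0
  sumUpTo-delta-beyond zero    c v 0<c = cong (λ b → indicator b * v 0) (≡ᵇ-false (λ c≡0 → <⇒≢ 0<c (sym c≡0)))
  sumUpTo-delta-beyond (suc k) c v k<c = cong₂ _+_
    (sumUpTo-delta-beyond k c v (<-trans (n<1+n k) k<c))
    (cong (λ b → indicator b * v (suc k)) (≡ᵇ-false (λ c≡ → <⇒≢ k<c (sym c≡))))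

  sumUpTo-delta : ∀ k c (v : ℕ → ℕ) → c ≤ k → sumUpTo k (λ a → indicator (c ≡ᵇ a) * v a) ≡ v c
  sumUpTo-delta zero    zero v _ = +-identityʳ _
  sumUpTo-delta (suc k) c v c≤ with m≤n⇒m<n∨m≡n c≤
  ... | inj₁ c<  = trans (cong₂ _+_ (sumUpTo-delta k c v (≤-pred c<))
                                    (cong (λ b → indicator b * v (suc k)) (≡ᵇ-false (<⇒≢ c<))))
                         (+-identityʳ _)
  ... | inj₂ refl = trans (cong₂ _+_ (sumUpTo-delta-beyond k (suc k) v ≤-refl)
                                     (cong (λ b → indicator b * v (suc k)) (≡ᵇ-refl (suc k))))
                          (+-identityʳ _)

  indicator-split-sum : ∀ p u q v k →
    indicator ((p ∧ q) ∧ (u + v ≡ᵇ k)) ≡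
    sumUpTo k (λ a → indicator (p ∧ (u ≡ᵇ a)) * indicator (q ∧ (v ≡ᵇ k ∸ a)))
  indicator-split-sum false u q v k = sym (sumUpTo-zero k)
  indicator-split-sum true  u q v k with u ℕ.≤? k
  ... | yes u≤k = sym (trans (sumUpTo-delta k u (λ a → indicator (q ∧ (v ≡ᵇ k ∸ a))) u≤k)
                             (cong (λ b → indicator (q ∧ b)) (sym sum≡)))
    where
    sum≡ : (u + v ≡ᵇ k) ≡ (v ≡ᵇ k ∸ u)
    sum≡ = T-injective (mk⇔
      (λ t → ≡⇒≡ᵇ v (k ∸ u) (trans (sym (m+n∸m≡n u v)) (cong (_∸ u) (≡ᵇ⇒≡ _ _ t))))
      (λ t → ≡⇒≡ᵇ (u + v) k (trans (cong (u +_) (≡ᵇ⇒≡ _ _ t)) (m+[n∸m]≡n u≤k))))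
  ... | no u≰k =
    trans (cong (λ b → indicator (q ∧ b)) (≡ᵇ-false (λ u+v≡k → u≰k (subst (u ≤_) u+v≡k (m≤m+n u v)))))
                       (too-large q)
    where
    too-large : ∀ q →
      indicator (q ∧ false) ≡ sumUpTo k (λ a → indicator (u ≡ᵇ a) * indicator (q ∧ (v ≡ᵇ k ∸ a)))
    too-large true  = sym (sumUpTo-delta-beyond k u _ (≰⇒> u≰k))
    too-large false = sym (sumUpTo-delta-beyond k u _ (≰⇒> u≰k))

  module BuildCounting (τ : List ℕ) (p q : List ℕ → Bool)
    (avoids-build : ∀ i {α} β → All (_< i) α → avoids τ (build i α β) ≡ p α ∧ q β) where

    isLeft isRight : ℕ → List ℕ → Bool
    isLeft  a α = p α ∧ (lis α ⊔ 1 ≡ᵇ a)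
    isRight b β = q β ∧ (lis β ≡ᵇ b)

    left right : ℕ → ℕ → ℕ
    left  i a = count (isLeft a) (S i)
    right l b = count (isRight b) (S l)

    private
      counted : ℕ → List ℕ → Bool
      counted k σ = avoids τ σ ∧ (lis σ ≡ᵇ k)

      over-β : ∀ n i k {α} → α ∈ S i →
        sumOver (λ β → indicator (counted k (build i α β))) (S (n ∸ i)) ≡
        sumUpTo k (λ a → indicator (isLeft a α) * right (n ∸ i) (k ∸ a))
      over-β n i k {α} α∈ = begin
        sumOver (λ β → indicator (counted k (build i α β))) (S (n ∸ i))
          ≡⟨ sumOver-cong∈ (S (n ∸ i)) (λ β _ → cong indicator
               (cong₂ _∧_ (avoids-build i β α<i) (cong (_≡ᵇ k) (Build.lis-build i β α<i)))) ⟩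
        sumOver (λ β → indicator ((p α ∧ q β) ∧ (lis α ⊔ 1 + lis β ≡ᵇ k))) (S (n ∸ i))
          ≡⟨ sumOver-cong∈ (S (n ∸ i)) (λ β _ → indicator-split-sum (p α) (lis α ⊔ 1) (q β) (lis β) k) ⟩
        sumOver (λ β → sumUpTo k (λ a → indicator (isLeft a α) * indicator (isRight (k ∸ a) β))) (S (n ∸ i))
          ≡⟨ sumOver-sumUpTo-comm _ (S (n ∸ i)) k ⟩
        sumUpTo k (λ a → sumOver (λ β → indicator (isLeft a α) * indicator (isRight (k ∸ a) β)) (S (n ∸ i)))
          ≡⟨ sumUpTo-cong k (λ a → trans
               (sumOver-*ˡ (indicator ∘ isRight (k ∸ a)) (indicator (isLeft a α)) (S (n ∸ i)))
               (cong (indicator (isLeft a α) *_) (sym (count≡sumOver (isRight (k ∸ a)) (S (n ∸ i)))))) ⟩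
        sumUpTo k (λ a → indicator (isLeft a α) * right (n ∸ i) (k ∸ a)) ∎
        where
        α<i : All (_< i) α
        α<i = proj₁ (proj₂ (proj₁ (S⁻ {i} α∈)))

      over-i : ∀ n k i →
        sumOver (indicator ∘ counted k) (cartesianProductWith (build i) (S i) (S (n ∸ i))) ≡
        sumUpTo k (λ a → left i a * right (n ∸ i) (k ∸ a))
      over-i n k i = begin
        sumOver (indicator ∘ counted k) (cartesianProductWith (build i) (S i) (S (n ∸ i)))
          ≡⟨ sumOver-cartesianProductWith _ (build i) (S i) (S (n ∸ i)) ⟩
        sumOver (λ α → sumOver (λ β → indicator (counted k (build i α β))) (S (n ∸ i))) (S i)
          ≡⟨ sumOver-cong∈ (S i) (λ α α∈ → over-β n i k α∈) ⟩
        sumOver (λ α → sumUpTo k (λ a → indicator (isLeft a α) * right (n ∸ i) (k ∸ a))) (S i)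
          ≡⟨ sumOver-sumUpTo-comm _ (S i) k ⟩
        sumUpTo k (λ a → sumOver (λ α → indicator (isLeft a α) * right (n ∸ i) (k ∸ a)) (S i))
          ≡⟨ sumUpTo-cong k (λ a → trans (sumOver-*ʳ (indicator ∘ isLeft a) (right (n ∸ i) (k ∸ a)) (S i))
               (cong (_* right (n ∸ i) (k ∸ a)) (sym (count≡sumOver (isLeft a) (S i))))) ⟩
        sumUpTo k (λ a → left i a * right (n ∸ i) (k ∸ a)) ∎

    Fcoef-suc : ∀ n k → Fcoef τ (suc n) k ≡ sumUpTo n (λ i → sumUpTo k (λ a → left i a * right (n ∸ i) (k ∸ a)))
    Fcoef-suc n k = begin
      Fcoef τ (suc n) k
        ≡⟨ count-filter (avoids p312) (counted k) (perms (suc n)) ⟩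
      count (counted k) (S (suc n))
        ≡⟨ count-↭ (counted k) (S↭builds n) ⟩
      count (counted k) (builds n)
        ≡⟨ count≡sumOver (counted k) (builds n) ⟩
      sumOver (indicator ∘ counted k) (builds n)
        ≡⟨ sumOver-concatMap _ (λ i → cartesianProductWith (build i) (S i) (S (n ∸ i))) (upTo (suc n)) ⟩
      sumOver (λ i → sumOver (indicator ∘ counted k) (cartesianProductWith (build i) (S i) (S (n ∸ i)))) (upTo (suc n))
        ≡⟨ sumOver-upTo _ n ⟩
      sumUpTo n (λ i → sumOver (indicator ∘ counted k) (cartesianProductWith (build i) (S i) (S (n ∸ i))))
        ≡⟨ sumUpTo-cong n (over-i n k) ⟩
      sumUpTo n (λ i → sumUpTo k (λ a → left i a * right (n ∸ i) (k ∸ a))) ∎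

module HatSeries where

  open BivariateSeries
  open IncreasingSubsequences
  open Building
  open Permutations
  open Enumeration
  open Counting
  open import Data.Bool.Base using (Bool; false; _∧_)
  open import Data.Integer.Base as ℤ using (ℤ; +_)
  import Data.Integer.Properties as ℤ
  open import Data.List.Base using (List; []; _∷_; null)

  private
    module ℛ = CommutativeRing ℤ[[q]][[x]].powerSeriesRing
  open ℛ using (_≈_; _+_; _*_; _-_; 1#)
  open import Data.List.Membership.Propositional using (_∈_)
  open import Data.List.Relation.Binary.Sublist.Propositional using (_∷_; minimum)
  open import Data.List.Relation.Unary.AllPairs using ([]; _∷_)
  open import Data.List.Relation.Unary.All using (All; [])
  open import Data.Nat.Base as ℕ using (ℕ; zero; suc; _∸_; _≤_; _⊔_; _≡ᵇ_; s≤s; z≤n)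
  open import Data.Nat.Properties using (m≥n⇒m⊔n≡m)
  open import Data.Product.Base using (∃₂; _,_; proj₁)
  open import Relation.Binary.PropositionalEquality as ≡ using (_≡_; refl; sym; trans; cong; cong₂)

  sumTo-zero : ∀ k → sumTo k (λ _ → + 0) ≡ + 0
  sumTo-zero zero    = refl
  sumTo-zero (suc k) = trans (ℤ.+-identityʳ _) (sumTo-zero k)

  sumTo-cong : ∀ k {f g : ℕ → ℤ} → (∀ a → f a ≡ g a) → sumTo k f ≡ sumTo k g
  sumTo-cong zero    f≡g = f≡g 0
  sumTo-cong (suc k) f≡g = cong₂ ℤ._+_ (sumTo-cong k f≡g) (f≡g (suc k))

  sumTo-at-0 : ∀ k (f : ℕ → ℤ) → (∀ a → f (suc a) ≡ + 0) → sumTo k f ≡ f 0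
  sumTo-at-0 zero    f f≡0 = refl
  sumTo-at-0 (suc k) f f≡0 = trans (cong₂ ℤ._+_ (sumTo-at-0 k f f≡0) (f≡0 k)) (ℤ.+-identityʳ _)

  sumTo-at-1 : ∀ n (f : ℕ → ℤ) → f 0 ≡ + 0 → (∀ i → f (suc (suc i)) ≡ + 0) → sumTo (suc n) f ≡ f 1
  sumTo-at-1 zero    f f0≡0 f≡0 = trans (cong (ℤ._+ f 1) f0≡0) (ℤ.+-identityˡ _)
  sumTo-at-1 (suc n) f f0≡0 f≡0 = trans (cong₂ ℤ._+_ (sumTo-at-1 n f f0≡0 f≡0) (f≡0 n)) (ℤ.+-identityʳ _)

  +-sumUpTo : ∀ n f → + sumUpTo n f ≡ sumTo n (λ i → + f i)
  +-sumUpTo zero    f = refl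
  +-sumUpTo (suc n) f = trans (ℤ.pos-+ (sumUpTo n f) _) (cong (ℤ._+ + f (suc n)) (+-sumUpTo n f))

  X⊗-zero : ∀ G k → (X ⊗ G) 0 k ≡ + 0
  X⊗-zero G k = sumTo-zero k

  X⊗-suc : ∀ G n k → (X ⊗ G) (suc n) k ≡ G n k
  X⊗-suc G n k = trans (sumTo-at-1 n _ (sumTo-zero k) (λ i → sumTo-zero k))
                       (trans (sumTo-at-0 k _ (λ a → refl)) (ℤ.*-identityˡ _))

  count-cong∈ : ∀ (p p′ : List ℕ → Bool) xs → (∀ x → x ∈ xs → p x ≡ p′ x) → count p xs ≡ count p′ xs
  count-cong∈ p p′ xs p≡p′ =
    trans (count≡sumOver p xs)
      (trans (sumOver-cong∈ xs (λ x x∈ → cong indicator (p≡p′ x x∈))) (sym (count≡sumOver p′ xs)))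

  count-false : ∀ xs → count (λ _ → false) xs ≡ 0
  count-false []       = refl
  count-false (x ∷ xs) = count-false xs

  S-suc-nonempty : ∀ {i α} → α ∈ S (suc i) → ∃₂ λ a α′ → α ≡ a ∷ α′
  S-suc-nonempty {i} {α} α∈ with proj₁ (proj₁ (S⁻ {suc i} α∈))
  S-suc-nonempty {i} {a ∷ α′} α∈ | _ = a , α′ , refl

  lis-nonempty : ∀ a α → 1 ≤ lis (a ∷ α)
  lis-nonempty a α = lis-upper (refl ∷ minimum α) ([] ∷ [])

  -- The pattern a ∷ τ′ is nonempty, so that the empty permutation avoids it.
  module GeneratingFunction (a : ℕ) (τ′ : List ℕ) (p q : List ℕ → Bool)
    (avoids-build : ∀ i {α} β → All (ℕ._< i) α → avoids (a ∷ τ′) (build i α β) ≡ p α ∧ q β) where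

    τ : List ℕ
    τ = a ∷ τ′

    open BuildCounting τ p q avoids-build

    Left Right : Series
    Left  i a = + left i a
    Right l b = + right l b

    F-coefficients : ∀ n k → F τ n k ≡ (oneS ⊕ X ⊗ (Left ⊗ Right)) n k
    F-coefficients zero    zero    = refl
    F-coefficients zero    (suc k) = sym (trans (ℤ.+-identityˡ _) (X⊗-zero (Left ⊗ Right) (suc k)))
    F-coefficients (suc n) k = begin
      + Fcoef τ (suc n) k
        ≡⟨ cong +_ (Fcoef-suc n k) ⟩
      + sumUpTo n (λ i → sumUpTo k (λ a → left i a ℕ.* right (n ∸ i) (k ∸ a)))
        ≡⟨ +-sumUpTo n _ ⟩
      sumTo n (λ i → + sumUpTo k (λ a → left i a ℕ.* right (n ∸ i) (k ∸ a)))
        ≡⟨ sumTo-cong n (λ i → trans (+-sumUpTo k _) (sumTo-cong k (λ a → ℤ.pos-* (left i a) _))) ⟩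
      (Left ⊗ Right) n k
        ≡⟨ X⊗-suc (Left ⊗ Right) n k ⟨
      (X ⊗ (Left ⊗ Right)) (suc n) k
        ≡⟨ ℤ.+-identityˡ _ ⟨
      (oneS ⊕ X ⊗ (Left ⊗ Right)) (suc n) k ∎
      where open ≡.≡-Reasoning

    F≈ : F τ ≈ 1# + X * (Left * Right)
    F≈ = ℛ.trans (coefficients⇒≈ F-coefficients)
                (ℛ.+-cong oneS≈1# (ℛ.trans (⊗≈* X (Left ⊗ Right)) (ℛ.*-congˡ {X} (⊗≈* Left Right))))

  lis⊔1-nonempty : ∀ {i α} → α ∈ S (suc i) → lis α ⊔ 1 ≡ lis α
  lis⊔1-nonempty {i} α∈ with S-suc-nonempty {i} α∈
  ... | a , α′ , refl = m≥n⇒m⊔n≡m (lis-nonempty a α′)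

  -- Only the empty permutation is weighted differently: by q (lis [] ⊔ 1 = 1) instead of 1.
  left-coefficients : ∀ b τ i c →
    + count (λ α → avoids (b ∷ τ) α ∧ (lis α ⊔ 1 ≡ᵇ c)) (S i) ≡ (F (b ∷ τ) ⊖ oneS ⊕ Q) i c
  left-coefficients b τ zero    zero          = refl
  left-coefficients b τ zero    (suc zero)    = refl
  left-coefficients b τ zero    (suc (suc c)) = refl
  left-coefficients b τ (suc i) c = sym (begin
    + Fcoef (b ∷ τ) (suc i) c ℤ.+ ℤ.- + 0 ℤ.+ + 0
      ≡⟨ trans (ℤ.+-identityʳ _) (ℤ.+-identityʳ _) ⟩
    + Fcoef (b ∷ τ) (suc i) c
      ≡⟨ cong +_ (count-filter (avoids p312) (λ α → avoids (b ∷ τ) α ∧ (lis α ≡ᵇ c)) (perms (suc i))) ⟩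
    + count (λ α → avoids (b ∷ τ) α ∧ (lis α ≡ᵇ c)) (S (suc i))
      ≡⟨ cong +_ (count-cong∈ _ _ (S (suc i)) (λ α α∈ →
           cong (λ l → avoids (b ∷ τ) α ∧ (l ≡ᵇ c)) (sym (lis⊔1-nonempty {i} α∈)))) ⟩
    + count (λ α → avoids (b ∷ τ) α ∧ (lis α ⊔ 1 ≡ᵇ c)) (S (suc i)) ∎)
    where open ≡.≡-Reasoning

  right-coefficients : ∀ τ l k → + count (λ β → avoids τ β ∧ (lis β ≡ᵇ k)) (S l) ≡ F τ l k
  right-coefficients τ l k = cong +_ (sym (count-filter (avoids p312) (λ β → avoids τ β ∧ (lis β ≡ᵇ k)) (perms l)))

  empty-coefficients : ∀ l k → + count (λ β → null β ∧ (lis β ≡ᵇ k)) (S l) ≡ oneS l k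
  empty-coefficients zero    zero    = refl
  empty-coefficients zero    (suc k) = refl
  empty-coefficients (suc l) k = cong +_ (trans (count-cong∈ _ (λ _ → false) (S (suc l)) nonempty) (count-false (S (suc l))))
    where
    nonempty : ∀ β → β ∈ S (suc l) → (null β ∧ (lis β ≡ᵇ k)) ≡ false
    nonempty β β∈ with S-suc-nonempty {l} β∈
    ... | _ , _ , refl = refl

  hat-recurrence : ∀ j → F (hat (3 ℕ.+ j)) ≈ 1# + X * ((F (hat (2 ℕ.+ j)) - 1# + Q) * F (hat (3 ℕ.+ j)))
  hat-recurrence j = ℛ.trans F≈ (ℛ.+-congˡ {1#} (ℛ.*-congˡ {X} (ℛ.*-cong Left≈ Right≈)))
    where
    open GeneratingFunction (suc (suc j)) (suc (suc (suc j)) ∷ downFrom (suc j))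
           (avoids (hat (2 ℕ.+ j))) (avoids (hat (3 ℕ.+ j))) (λ i β α<i → Build.avoids-hat i β α<i j)
    Left≈ : Left ≈ F (hat (2 ℕ.+ j)) - 1# + Q
    Left≈ = ℛ.trans (coefficients⇒≈ (left-coefficients (suc j) _))
                    (ℛ.+-congʳ {Q} (ℛ.+-congˡ {F (hat (2 ℕ.+ j))} (ℛ.-‿cong oneS≈1#)))
    Right≈ : Right ≈ F (hat (3 ℕ.+ j))
    Right≈ = coefficients⇒≈ (right-coefficients (hat (3 ℕ.+ j)))

  hat-base : F (hat 2) ≈ 1# + X * (F (hat 2) - 1# + Q)
  hat-base = ℛ.trans F≈ (ℛ.+-congˡ {1#} (ℛ.*-congˡ {X}
    (ℛ.trans (ℛ.*-cong Left≈ Right≈) (ℛ.*-identityʳ (F (hat 2) - 1# + Q)))))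
    where
    open GeneratingFunction 1 (2 ∷ []) (avoids (hat 2)) null (λ i β α<i → Build.avoids-12 i β α<i)
    Left≈ : Left ≈ F (hat 2) - 1# + Q
    Left≈ = ℛ.trans (coefficients⇒≈ (left-coefficients 1 _))
                    (ℛ.+-congʳ {Q} (ℛ.+-congˡ {F (hat 2)} (ℛ.-‿cong oneS≈1#)))
    Right≈ : Right ≈ 1#
    Right≈ = ℛ.trans (coefficients⇒≈ empty-coefficients) oneS≈1#

  F-hat⊗denom≈numer : ∀ j → F (hat (3 ℕ.+ j)) ⊗ denom (3 ℕ.+ j) ≈ numer (3 ℕ.+ j)
  F-hat⊗denom≈numer j = ℛ.trans (⊗≈* (F (hat (3 ℕ.+ j))) (denom (3 ℕ.+ j)))
    (HatRecurrence.A*denom≈numer (λ j → F (hat (2 ℕ.+ j))) hat-recurrence hat-base j)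

open BivariateSeries
open HatSeries

corollary3p6 : (m : ℕ) → 3 ≤ m → (n k : ℕ) →
    (F (hat m) ⊗ denom m) n k ≡ numer m n k
corollary3p6 (suc (suc (suc j))) (s≤s (s≤s (s≤s z≤n))) = ≈⇒coefficients (F-hat⊗denom≈numer j)
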